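{- Let $\delta\le2^{ -(w-1)}$. Let $\mathcal{D}$ be a distribution on $\{\pm1\}^n$ that $\varepsilon$-fools all $\delta$-reachable read-once branching programs of length $n$ and width $w+1$. Then $\mathcal{D}$ also fools all read-once branching programs of width $w$ and length $n$ with at most $\ell$ colliding layers, with error at most $(\ell w+1)\cdot\varepsilon+(2^w w\ell)\cdot\delta$.
   Context: A read-once branching program (ROBP) of width $w$ and length $n$ is a layered directed graph with layers $V_1,\dots,V_{n+1}$, $V_1$ a single start vertex, other layers of at most $w$ vertices, each vertex of $V_i$ having two outgoing edges into $V_{i+1}$ labeled $1$ and $-1$, vertices of $V_{n+1}$ labeled accept/reject; on input $x$, step $i$ follows the edge labeled $x_i$. A layer of edges is colliding if two edges with the same label enter the same vertex of the next layer. For a vertex $v$, $p_v$ is the probability of reaching $v$ on a uniformly random input; the program is $\delta$-reachable if $p_v\ge\delta$ for every reachable vertex $v$. $\mathcal{D}$ $\varepsilon$-fools a class of Boolean functions $f$ if $|\Pr_{x\sim\mathcal{D}}[f(x)=1]-\Pr_{x\sim U_n}[f(x)=1]|\le\varepsilon$ for each $f$ in the class.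
   Formalization: The distribution $\mathcal{D}$ takes rational probabilities, and the parameters ε and δ are rational. -}

module Defs where

open import Data.Bool using (Bool; true; false; if_then_else_)
open import Data.Nat as ℕ using (ℕ; zero; suc)
open import Data.Fin using (Fin; toℕ; _≟_)
open import Data.Vec using (Vec; []; _∷_; lookup)
open import Data.List using (List; []; _∷_; map; _++_; length)
open import Data.List.Membership.Propositional using (_∈_)
open import Data.Integer using (+_)
open import Data.Rational using (ℚ; 0ℚ; 1ℚ; _+_; _*_; _/_; ½)
open import Data.Product using (Σ; ∃; _×_)
open import Relation.Nullary using (¬_; does)
open import Relation.Binary.PropositionalEquality using (_≡_; _≢_)

-- Bits: true stands for +1, false for -1.
Input : ℕ → Set
Input n = Vec Bool n

allInputs : (n : ℕ) → List (Input n)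
allInputs zero = [] ∷ []
allInputs (suc n) = map (true ∷_) (allInputs n) ++ map (false ∷_) (allInputs n)

sumℚ : List ℚ → ℚ
sumℚ [] = 0ℚ
sumℚ (q ∷ qs) = q + sumℚ qs

ℕtoℚ : ℕ → ℚ
ℕtoℚ k = + k / 1

half^ : ℕ → ℚ
half^ zero = 1ℚ
half^ (suc k) = ½ * half^ k

indicator : Bool → ℚ
indicator b = if b then 1ℚ else 0ℚ

record Distribution (n : ℕ) : Set where
  field
    mass : Input n → ℚ
    mass-nonneg : ∀ x → Data.Rational._≤_ 0ℚ (mass x)
    mass-sum : sumℚ (map mass (allInputs n)) ≡ 1ℚ
open Distribution public

PrD : ∀ {n} → Distribution n → (Input n → Bool) → ℚ
PrD {n} D f = sumℚ (map (λ x → mass D x * indicator (f x)) (allInputs n))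

PrU : ∀ {n} → (Input n → Bool) → ℚ
PrU {n} f = sumℚ (map (λ x → half^ n * indicator (f x)) (allInputs n))

Layer : ℕ → Set
Layer w = Fin w → Bool → Fin w

-- Every layer V_1,…,V_{n+1} is represented by Fin w (layers with fewer
-- vertices are padded with unreachable dummy vertices); V_1's single
-- vertex is 'start'.
record ROBP (n w : ℕ) : Set where
  field
    start : Fin w
    layers : Vec (Layer w) n
    accept : Fin w → Bool
open ROBP public

runPrefix : ∀ {w m} → ℕ → Vec (Layer w) m → Input m → Fin w → Fin w
runPrefix zero _ _ s = s
runPrefix (suc i) [] [] s = s
runPrefix (suc i) (f ∷ fs) (b ∷ bs) s = runPrefix i fs bs (f s b)

eval : ∀ {n w} → ROBP n w → Input n → Bool
eval {n} P x = accept P (runPrefix n (layers P) x (start P))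

-- p_v for v in layer V_{i+1} (i = 0,…,n): probability of reaching v
reachProb : ∀ {n w} → ROBP n w → Fin (suc n) → Fin w → ℚ
reachProb P i v = PrU (λ x → does (runPrefix (toℕ i) (layers P) x (start P) ≟ v))

Reachable : ∀ {n w} → ℚ → ROBP n w → Set
Reachable {n} {w} δ P =
  ∀ (i : Fin (suc n)) (v : Fin w) →
    Data.Rational._<_ 0ℚ (reachProb P i v) → Data.Rational._≤_ δ (reachProb P i v)

Colliding : ∀ {n w} → ROBP n w → Fin n → Set
Colliding {w = w} P j =
  ∃ λ (u : Fin w) → ∃ λ (u' : Fin w) → ∃ λ (b : Bool) →
    u ≢ u' × lookup (layers P) j u b ≡ lookup (layers P) j u' b

AtMostCollidingLayers : ∀ {n w} → ℕ → ROBP n w → Set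
AtMostCollidingLayers {n} ℓ P =
  Σ (List (Fin n)) λ S → (length S ℕ.≤ ℓ) × (∀ j → Colliding P j → j ∈ S)

Fools : ∀ {n} → Distribution n → ℚ → (Input n → Bool) → Set
Fools D ε f = Data.Rational._≤_ (Data.Rational.∣_∣ (PrD D f Data.Rational.- PrU f)) ε

{-# OPTIONS --safe #-}
-- Prune the program: at each colliding layer, in increasing order, redirect the edges entering
-- light vertices (probability below θ = 2^(w-1)·δ) to a heavy vertex. Every hybrid satisfies,
-- up to the layers pruned so far, the invariant that in a layer with r reached vertices each
-- reached vertex has probability at least 2^(w-r)·δ: pruning forces probability θ, and a
-- non-colliding layer keeps it since a vertex entered along one label only makes r grow. So the
-- fully pruned program, with a dead vertex added (width w+1), is δ-reachable, hence ε-fooled.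
-- Pruning one layer changes the function only on inputs entering a light vertex; under D that
-- event is bounded by a δ-reachable width-(w+1) probe testing the vertex, or its unique
-- predecessor when it is lighter than δ, so each of the w vertices of each of the ℓ colliding
-- layers costs at most ε + 2^w·δ.
module Submission where

open import Defs

module Proof where

  open import Data.Bool as Bool using (Bool; true; false; not; if_then_else_; _∧_; _∨_)
  import Data.Bool.Properties as Bool
  open import Data.Bool.ListAction using (any)
  open import Data.Empty using (⊥; ⊥-elim)
  open import Data.Fin as Fin using (Fin; toℕ)
  import Data.Fin.Properties as Fin
  import Data.Integer as ℤ
  import Data.Integer.Properties as ℤ
  open import Data.List using (List; []; _∷_; map; _++_; length)
  open import Data.List.Membership.Propositional using (_∈_)
  open import Data.List.Relation.Unary.Any using (here; there)
  open import Data.Nat as ℕ using (ℕ; zero; suc; _∸_; z≤n; s≤s)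
  import Data.Nat.Properties as ℕ
  open import Algebra.Properties.CommutativeSemigroup ℕ.+-commutativeSemigroup
    using () renaming (interchange to ℕ+-interchange; x∙yz≈y∙xz to ℕ+-exchange)
  open import Data.Product using (∃; _×_; _,_; proj₁; proj₂)
  open import Data.Rational
  open import Data.Rational.Properties
  open import Algebra.Properties.CommutativeMonoid.Sum +-0-commutativeMonoid using (sum; ∑-distrib-+)
  import Data.Rational.Unnormalised as ᵘ
  import Data.Rational.Unnormalised.Properties as ᵘ
  open import Data.Sum using (_⊎_; inj₁; inj₂)
  open import Data.Vec as Vec using (Vec; []; _∷_)
  open import Function using (_∘_)
  open import Function.Definitions using (Injective)
  open import Level using (0ℓ)
  open import Relation.Binary.Definitions using (tri<; tri≈; tri>)
  open import Relation.Binary.PropositionalEquality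
  open import Relation.Nullary using (¬_; Dec; yes; no; does)
  open import Relation.Nullary.Decidable using (dec⇒maybe; dec-true; dec-false; _×-dec_; ¬?)
  open import Tactic.RingSolver using (solve-∀)
  open import Tactic.RingSolver.Core.AlmostCommutativeRing using (AlmostCommutativeRing; fromCommutativeRing)

  ringℚ : AlmostCommutativeRing 0ℓ 0ℓ
  ringℚ = fromCommutativeRing +-*-commutativeRing (λ x → dec⇒maybe (0ℚ ≟ x))

  ℕtoℚᵘ : ℕ → ᵘ.ℚᵘ
  ℕtoℚᵘ k = ᵘ.mkℚᵘ (ℤ.+ k) 0

  toℚᵘ-ℕtoℚ : ∀ k → toℚᵘ (ℕtoℚ k) ᵘ.≃ ℕtoℚᵘ k
  toℚᵘ-ℕtoℚ k = toℚᵘ-fromℚᵘ (ℕtoℚᵘ k)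

  ℕtoℚ-+ : ∀ a b → ℕtoℚ (a ℕ.+ b) ≡ ℕtoℚ a + ℕtoℚ b
  ℕtoℚ-+ a b = toℚᵘ-injective (ᵘ.≃-trans (toℚᵘ-ℕtoℚ (a ℕ.+ b)) (ᵘ.≃-trans ℕtoℚᵘ-+
    (ᵘ.≃-sym (ᵘ.≃-trans (toℚᵘ-homo-+ (ℕtoℚ a) (ℕtoℚ b))
                        (ᵘ.+-cong (toℚᵘ-ℕtoℚ a) (toℚᵘ-ℕtoℚ b))))))
    where
    ℕtoℚᵘ-+ : ℕtoℚᵘ (a ℕ.+ b) ᵘ.≃ ℕtoℚᵘ a ᵘ.+ ℕtoℚᵘ b
    ℕtoℚᵘ-+ = ᵘ.*≡* (cong (ℤ._* ℤ.+ 1) (trans (ℤ.pos-+ a b)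
      (sym (cong₂ ℤ._+_ (ℤ.*-identityʳ (ℤ.+ a)) (ℤ.*-identityʳ (ℤ.+ b))))))

  ℕtoℚ-* : ∀ a b → ℕtoℚ (a ℕ.* b) ≡ ℕtoℚ a * ℕtoℚ b
  ℕtoℚ-* a b = toℚᵘ-injective (ᵘ.≃-trans (toℚᵘ-ℕtoℚ (a ℕ.* b)) (ᵘ.≃-trans ℕtoℚᵘ-*
    (ᵘ.≃-sym (ᵘ.≃-trans (toℚᵘ-homo-* (ℕtoℚ a) (ℕtoℚ b))
                        (ᵘ.*-cong (toℚᵘ-ℕtoℚ a) (toℚᵘ-ℕtoℚ b))))))
    where
    ℕtoℚᵘ-* : ℕtoℚᵘ (a ℕ.* b) ᵘ.≃ ℕtoℚᵘ a ᵘ.* ℕtoℚᵘ b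
    ℕtoℚᵘ-* = ᵘ.*≡* (cong (ℤ._* ℤ.+ 1) (ℤ.pos-* a b))

  ℕtoℚ-mono-≤ : ∀ {a b} → a ℕ.≤ b → ℕtoℚ a ≤ ℕtoℚ b
  ℕtoℚ-mono-≤ {a} {b} a≤b = toℚᵘ-cancel-≤
    (ᵘ.≤-respʳ-≃ (ᵘ.≃-sym (toℚᵘ-ℕtoℚ b)) (ᵘ.≤-respˡ-≃ (ᵘ.≃-sym (toℚᵘ-ℕtoℚ a))
      (ᵘ.*≤* (ℤ.*-monoʳ-≤-nonNeg (ℤ.+ 1) (ℤ.+≤+ a≤b)))))

  ℕtoℚ-nonNeg : ∀ a → 0ℚ ≤ ℕtoℚ a
  ℕtoℚ-nonNeg a = ℕtoℚ-mono-≤ {0} {a} z≤n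

  half^-nonNeg : ∀ k → 0ℚ ≤ half^ k
  half^-nonNeg zero = ≤ᵇ⇒≤ _
  half^-nonNeg (suc k) = nonNegative⁻¹ _ {{nonNeg*nonNeg⇒nonNeg ½ (half^ k) {{nonNegative (half^-nonNeg k)}}}}

  half^*2^≡1 : ∀ k → half^ k * ℕtoℚ (2 ℕ.^ k) ≡ 1ℚ
  half^*2^≡1 zero = refl
  half^*2^≡1 (suc k) = begin
    ½ * half^ k * ℕtoℚ (2 ℕ.* 2 ℕ.^ k)        ≡⟨ cong (½ * half^ k *_) (ℕtoℚ-* 2 (2 ℕ.^ k)) ⟩
    ½ * half^ k * (ℕtoℚ 2 * ℕtoℚ (2 ℕ.^ k))  ≡⟨ interchange ½ (half^ k) (ℕtoℚ 2) _ ⟩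
    ½ * ℕtoℚ 2 * (half^ k * ℕtoℚ (2 ℕ.^ k))  ≡⟨ cong (½ * ℕtoℚ 2 *_) (half^*2^≡1 k) ⟩
    ½ * ℕtoℚ 2 * 1ℚ                           ≡⟨⟩
    1ℚ                                          ∎
    where
    open ≡-Reasoning
    interchange : ∀ a b c d → a * b * (c * d) ≡ a * c * (b * d)
    interchange = solve-∀ ringℚ

  double-cancel-≤ : ∀ {p q} → p + p ≤ q + q → p ≤ q
  double-cancel-≤ {p} {q} p+p≤q+q with p ≤? q
  ... | yes p≤q = p≤q
  ... | no p≰q = ⊥-elim (<-irrefl refl (<-≤-trans (+-mono-< (≰⇒> p≰q) (≰⇒> p≰q)) p+p≤q+q))

  p≤∣p∣ : ∀ p → p ≤ ∣ p ∣
  p≤∣p∣ p with ≤-total 0ℚ p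
  ... | inj₁ 0≤p = ≤-reflexive (sym (0≤p⇒∣p∣≡p 0≤p))
  ... | inj₂ p≤0 = ≤-trans p≤0 (0≤∣p∣ p)

  p≤q⇒-p≤q⇒∣p∣≤q : ∀ {p q} → p ≤ q → - p ≤ q → ∣ p ∣ ≤ q
  p≤q⇒-p≤q⇒∣p∣≤q {p} p≤q -p≤q with ∣p∣≡p∨∣p∣≡-p p
  ... | inj₁ ∣p∣≡p = subst (_≤ _) (sym ∣p∣≡p) p≤q
  ... | inj₂ ∣p∣≡-p = subst (_≤ _) (sym ∣p∣≡-p) -p≤q

  ∣p-q∣≤r : ∀ {p q r} → p ≤ q + r → q ≤ p + r → ∣ p - q ∣ ≤ r
  ∣p-q∣≤r {p} {q} {r} p≤q+r q≤p+r =
    p≤q⇒-p≤q⇒∣p∣≤q (shift p≤q+r) (subst (_≤ r) (neg-difference q p) (shift q≤p+r))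
    where
    shift : ∀ {a b} → a ≤ b + r → a - b ≤ r
    shift {a} {b} a≤b+r = subst (a - b ≤_) (cancel b r) (+-monoˡ-≤ (- b) a≤b+r)
      where
      cancel : ∀ b r → b + r - b ≡ r
      cancel = solve-∀ ringℚ
    neg-difference : ∀ a b → a - b ≡ - (b - a)
    neg-difference = solve-∀ ringℚ

  ∣p-q∣≤r⇒p≤q+r : ∀ {p q r} → ∣ p - q ∣ ≤ r → p ≤ q + r
  ∣p-q∣≤r⇒p≤q+r {p} {q} {r} ∣p-q∣≤r =
    subst (_≤ q + r) (q+[p-q]≡p q p) (+-monoʳ-≤ q (≤-trans (p≤∣p∣ (p - q)) ∣p-q∣≤r))
    where
    q+[p-q]≡p : ∀ q p → q + (p - q) ≡ p
    q+[p-q]≡p = solve-∀ ringℚ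

  ∣p-q∣≤∣r-s∣+∣p-r∣+∣q-s∣ : ∀ p q r s → ∣ p - q ∣ ≤ ∣ r - s ∣ + (∣ p - r ∣ + ∣ q - s ∣)
  ∣p-q∣≤∣r-s∣+∣p-r∣+∣q-s∣ p q r s = begin
    ∣ p - q ∣                              ≡⟨ cong ∣_∣ (regroup p q r s) ⟩
    ∣ (r - s) + ((p - r) - (q - s)) ∣      ≤⟨ ∣p+q∣≤∣p∣+∣q∣ (r - s) _ ⟩
    ∣ r - s ∣ + ∣ (p - r) - (q - s) ∣      ≤⟨ +-monoʳ-≤ ∣ r - s ∣ (∣p-q∣≤∣p∣+∣q∣ (p - r) (q - s)) ⟩
    ∣ r - s ∣ + (∣ p - r ∣ + ∣ q - s ∣)    ∎
    where
    open ≤-Reasoning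
    regroup : ∀ p q r s → p - q ≡ (r - s) + ((p - r) - (q - s))
    regroup = solve-∀ ringℚ

  +-cancelˡ-≤ : ∀ p {q r} → p + q ≤ p + r → q ≤ r
  +-cancelˡ-≤ p {q} {r} p+q≤p+r = subst₂ _≤_ (cancel p q) (cancel p r) (+-monoʳ-≤ (- p) p+q≤p+r)
    where
    cancel : ∀ p q → - p + (p + q) ≡ q
    cancel = solve-∀ ringℚ

  x≤y+x : ∀ x {y} → 0ℚ ≤ y → x ≤ y + x
  x≤y+x x {y} y≥0 = subst (_≤ y + x) (+-identityˡ x) (+-monoˡ-≤ x y≥0)

  x≤k*x : ∀ k {x} → 1 ℕ.≤ k → 0ℚ ≤ x → x ≤ ℕtoℚ k * x
  x≤k*x k {x} 1≤k x≥0 =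
    subst (_≤ ℕtoℚ k * x) (*-identityˡ x) (*-monoʳ-≤-nonNeg x {{nonNegative x≥0}} (ℕtoℚ-mono-≤ 1≤k))

  false≢true : false ≢ true
  false≢true ()

  does-true⇒ : ∀ {A : Set} (a? : Dec A) → does a? ≡ true → A
  does-true⇒ (yes a) _ = a

  does-false⇒¬ : ∀ {A : Set} (a? : Dec A) → does a? ≡ false → ¬ A
  does-false⇒¬ (no ¬a) _ = ¬a

  _==_ : ∀ {w} → Fin w → Fin w → Bool
  u == v = does (u Fin.≟ v)

  ==-refl : ∀ {w} (u : Fin w) → u == u ≡ true
  ==-refl u = dec-true (u Fin.≟ u) refl

  ==⇒≡ : ∀ {w} {u v : Fin w} → u == v ≡ true → u ≡ v
  ==⇒≡ {u = u} {v} = does-true⇒ (u Fin.≟ v)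

  ≢⇒==false : ∀ {w} {u v : Fin w} → u ≢ v → u == v ≡ false
  ≢⇒==false {u = u} {v} = dec-false (u Fin.≟ v)

  Fin≤1-irrelevant : ∀ {w} → w ℕ.≤ 1 → (u v : Fin w) → u ≡ v
  Fin≤1-irrelevant (s≤s z≤n) Fin.zero Fin.zero = refl

  wsum : ∀ {X : Set} → (X → ℚ) → List X → (X → Bool) → ℚ
  wsum wt xs p = sumℚ (map (λ x → wt x * indicator (p x)) xs)

  wsum-cong : ∀ {X : Set} (wt : X → ℚ) xs {p q : X → Bool} →
              (∀ x → p x ≡ q x) → wsum wt xs p ≡ wsum wt xs q
  wsum-cong wt []       p≗q = refl
  wsum-cong wt (x ∷ xs) p≗q = cong₂ (λ b s → wt x * indicator b + s) (p≗q x) (wsum-cong wt xs p≗q)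

  wsum-none : ∀ {X : Set} (wt : X → ℚ) xs {p : X → Bool} → (∀ x → p x ≡ false) → wsum wt xs p ≡ 0ℚ
  wsum-none wt []       p≗false = refl
  wsum-none wt (x ∷ xs) p≗false
    rewrite p≗false x | wsum-none wt xs p≗false = trans (+-identityʳ _) (*-zeroʳ (wt x))

  module _ {X : Set} {wt : X → ℚ} (wt≥0 : ∀ x → 0ℚ ≤ wt x) where

    private
      *-monoˡ-wt : ∀ x {a b} → a ≤ b → wt x * a ≤ wt x * b
      *-monoˡ-wt x = *-monoˡ-≤-nonNeg (wt x) {{nonNegative (wt≥0 x)}}

      indicator-nonNeg : ∀ b → 0ℚ ≤ indicator b
      indicator-nonNeg true  = ≤ᵇ⇒≤ _
      indicator-nonNeg false = ≤-refl

      indicator-mono : ∀ {a b} → (a ≡ true → b ≡ true) → indicator a ≤ indicator b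
      indicator-mono {true}  a⇒b rewrite a⇒b refl = ≤-refl
      indicator-mono {false} {b} _ = indicator-nonNeg b

      indicator-∨ : ∀ {a b c} → (a ≡ true → b ≡ true ⊎ c ≡ true) → indicator a ≤ indicator b + indicator c
      indicator-∨ {false} {b} {c} _ = +-mono-≤ (indicator-nonNeg b) (indicator-nonNeg c)
      indicator-∨ {true}  {b} {c} a⇒b∨c with a⇒b∨c refl
      ... | inj₁ refl = subst (_≤ 1ℚ + indicator c) (+-identityʳ 1ℚ) (+-monoʳ-≤ 1ℚ (indicator-nonNeg c))
      ... | inj₂ refl = subst (_≤ indicator b + 1ℚ) (+-identityˡ 1ℚ) (+-monoˡ-≤ 1ℚ (indicator-nonNeg b))

    wsum-nonNeg : ∀ xs p → 0ℚ ≤ wsum wt xs p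
    wsum-nonNeg []       p = ≤-refl
    wsum-nonNeg (x ∷ xs) p = +-mono-≤
      (subst (_≤ wt x * indicator (p x)) (*-zeroʳ (wt x)) (*-monoˡ-wt x (indicator-nonNeg (p x))))
      (wsum-nonNeg xs p)

    wsum≤total : ∀ xs p → wsum wt xs p ≤ sumℚ (map wt xs)
    wsum≤total []       p = ≤-refl
    wsum≤total (x ∷ xs) p = +-mono-≤
      (subst (wt x * indicator (p x) ≤_) (*-identityʳ (wt x)) (*-monoˡ-wt x (indicator≤1 (p x))))
      (wsum≤total xs p)
      where
      indicator≤1 : ∀ b → indicator b ≤ 1ℚ
      indicator≤1 true  = ≤-refl
      indicator≤1 false = ≤ᵇ⇒≤ _

    wsum-mono : ∀ xs {p q : X → Bool} → (∀ x → p x ≡ true → q x ≡ true) → wsum wt xs p ≤ wsum wt xs q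
    wsum-mono []       p⊆q = ≤-refl
    wsum-mono (x ∷ xs) p⊆q = +-mono-≤ (*-monoˡ-wt x (indicator-mono (p⊆q x))) (wsum-mono xs p⊆q)

    wsum-∪ : ∀ xs {p q r : X → Bool} → (∀ x → p x ≡ true → q x ≡ true ⊎ r x ≡ true) →
             wsum wt xs p ≤ wsum wt xs q + wsum wt xs r
    wsum-∪ []       p⊆q∪r = ≤ᵇ⇒≤ _
    wsum-∪ (x ∷ xs) {p} {q} {r} p⊆q∪r = begin
      wt x * indicator (p x) + wsum wt xs p
        ≤⟨ +-mono-≤ (*-monoˡ-wt x (indicator-∨ (p⊆q∪r x))) (wsum-∪ xs p⊆q∪r) ⟩
      wt x * (indicator (q x) + indicator (r x)) + (wsum wt xs q + wsum wt xs r)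
        ≡⟨ regroup (wt x) (indicator (q x)) (indicator (r x)) (wsum wt xs q) (wsum wt xs r) ⟩
      (wt x * indicator (q x) + wsum wt xs q) + (wt x * indicator (r x) + wsum wt xs r) ∎
      where
      open ≤-Reasoning
      regroup : ∀ w a b s t → w * (a + b) + (s + t) ≡ (w * a + s) + (w * b + t)
      regroup = solve-∀ ringℚ

    wsum-⋃ : ∀ xs {k} (q : Fin k → X → Bool) {p : X → Bool} →
             (∀ x → p x ≡ true → ∃ λ v → q v x ≡ true) → wsum wt xs p ≤ sum (λ v → wsum wt xs (q v))
    wsum-⋃ xs {zero} q {p} p⊆⋃q = ≤-reflexive (wsum-none wt xs p≗false)
      where
      p≗false : ∀ x → p x ≡ false
      p≗false x with p x in px
      ... | true  with () ← proj₁ (p⊆⋃q x px)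
      ... | false = refl
    wsum-⋃ xs {suc k} q {p} p⊆⋃q = ≤-trans (wsum-∪ xs {p} {q Fin.zero} {rest} split)
      (+-monoʳ-≤ (wsum wt xs (q Fin.zero)) (wsum-⋃ xs (λ v → q (Fin.suc v)) rest⊆⋃q))
      where
      rest : X → Bool
      rest x = p x ∧ not (q Fin.zero x)
      split : ∀ x → p x ≡ true → q Fin.zero x ≡ true ⊎ rest x ≡ true
      split x px with q Fin.zero x
      ... | true  = inj₁ refl
      ... | false rewrite px = inj₂ refl
      rest⊆⋃q : ∀ x → rest x ≡ true → ∃ λ v → q (Fin.suc v) x ≡ true
      rest⊆⋃q x rx with p⊆⋃q x (Bool.∧-conicalˡ _ _ rx)
      ... | Fin.suc v , qvx = v , qvx
      ... | Fin.zero  , q₀x = ⊥-elim (false≢true (trans (cong not (sym q₀x)) (Bool.∧-conicalʳ (p x) _ rx)))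

    wsum-agree : ∀ xs {p q h : X → Bool} → (∀ x → h x ≡ false → p x ≡ q x) →
                 ∣ wsum wt xs p - wsum wt xs q ∣ ≤ wsum wt xs h
    wsum-agree xs {p} {q} {h} agree = ∣p-q∣≤r
      (≤-trans (wsum-∪ xs (covered p q (λ x hx → sym (agree x hx)))) (≤-reflexive (+-comm (wsum wt xs h) _)))
      (≤-trans (wsum-∪ xs (covered q p agree)) (≤-reflexive (+-comm (wsum wt xs h) _)))
      where
      covered : ∀ f g → (∀ x → h x ≡ false → g x ≡ f x) → ∀ x → f x ≡ true → h x ≡ true ⊎ g x ≡ true
      covered f g g≗f x fx with h x in hx
      ... | true  = inj₁ refl
      ... | false = inj₂ (trans (g≗f x hx) fx)

  sum≤ : ∀ {k} (f : Fin k → ℚ) c → (∀ v → f v ≤ c) → sum f ≤ ℕtoℚ k * c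
  sum≤ {zero}  f c f≤c = ≤-reflexive (sym (*-zeroˡ c))
  sum≤ {suc k} f c f≤c = begin
    f Fin.zero + sum (f ∘ Fin.suc)   ≤⟨ +-mono-≤ (f≤c Fin.zero) (sum≤ (f ∘ Fin.suc) c (f≤c ∘ Fin.suc)) ⟩
    c + ℕtoℚ k * c                   ≡⟨ c+kc≡[1+k]c c (ℕtoℚ k) ⟩
    (1ℚ + ℕtoℚ k) * c                ≡⟨ cong (_* c) (sym (ℕtoℚ-+ 1 k)) ⟩
    ℕtoℚ (suc k) * c                 ∎
    where
    open ≤-Reasoning
    c+kc≡[1+k]c : ∀ c k → c + k * c ≡ (1ℚ + k) * c
    c+kc≡[1+k]c = solve-∀ ringℚ

  indicatorℕ : Bool → ℕ
  indicatorℕ true  = 1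
  indicatorℕ false = 0

  indicatorℕ≤1 : ∀ b → indicatorℕ b ℕ.≤ 1
  indicatorℕ≤1 true  = ℕ.≤-refl
  indicatorℕ≤1 false = z≤n

  count : ∀ {n} → (Input n → Bool) → ℕ
  count {zero}  p = indicatorℕ (p [])
  count {suc n} p = count (λ x → p (true ∷ x)) ℕ.+ count (λ x → p (false ∷ x))

  count-cong : ∀ {n} {p q : Input n → Bool} → (∀ x → p x ≡ q x) → count p ≡ count q
  count-cong {zero}  p≗q = cong indicatorℕ (p≗q [])
  count-cong {suc n} p≗q = cong₂ ℕ._+_ (count-cong (λ x → p≗q (true ∷ x))) (count-cong (λ x → p≗q (false ∷ x)))

  count-none : ∀ {n} {p : Input n → Bool} → (∀ x → p x ≡ false) → count p ≡ 0
  count-none {zero}  p≗false rewrite p≗false [] = refl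
  count-none {suc n} p≗false
    rewrite count-none (λ x → p≗false (true ∷ x)) | count-none (λ x → p≗false (false ∷ x)) = refl

  count-all : ∀ n → count {n} (λ _ → true) ≡ 2 ℕ.^ n
  count-all zero    = refl
  count-all (suc n) = trans (cong (λ c → c ℕ.+ c) (count-all n)) (cong (2 ℕ.^ n ℕ.+_) (sym (ℕ.+-identityʳ _)))

  count-mono : ∀ {n} {p q : Input n → Bool} → (∀ x → p x ≡ true → q x ≡ true) → count p ℕ.≤ count q
  count-mono {zero} {p} p⊆q with p [] in p[]
  ... | true  rewrite p⊆q [] p[] = ℕ.≤-refl
  ... | false = z≤n
  count-mono {suc n} p⊆q = ℕ.+-mono-≤ (count-mono (λ x → p⊆q (true ∷ x))) (count-mono (λ x → p⊆q (false ∷ x)))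

  count-disjoint : ∀ {n} {p q r : Input n → Bool} → (∀ x → p x ≡ true → q x ≡ true → ⊥) →
                   (∀ x → p x ≡ true → r x ≡ true) → (∀ x → q x ≡ true → r x ≡ true) →
                   count p ℕ.+ count q ℕ.≤ count r
  count-disjoint {zero} {p} {q} p∩q p⊆r q⊆r with p [] in p[] | q [] in q[]
  ... | true  | true  = ⊥-elim (p∩q [] p[] q[])
  ... | true  | false rewrite p⊆r [] p[] = ℕ.≤-refl
  ... | false | true  rewrite q⊆r [] q[] = ℕ.≤-refl
  ... | false | false = z≤n
  count-disjoint {suc n} {p} {q} p∩q p⊆r q⊆r =
    ℕ.≤-trans (ℕ.≤-reflexive (ℕ+-interchange (count {n} (λ x → p (true ∷ x))) _ _ _))
    (ℕ.+-mono-≤ (count-disjoint (λ x → p∩q (true ∷ x)) (λ x → p⊆r (true ∷ x)) (λ x → q⊆r (true ∷ x)))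
                (count-disjoint (λ x → p∩q (false ∷ x)) (λ x → p⊆r (false ∷ x)) (λ x → q⊆r (false ∷ x))))

  count-split : ∀ {n} (p q : Input n → Bool) → count p ≡ count (λ x → p x ∧ q x) ℕ.+ count (λ x → p x ∧ not (q x))
  count-split {zero} p q with p [] | q []
  ... | true  | true  = refl
  ... | true  | false = refl
  ... | false | _     = refl
  count-split {suc n} p q = trans (cong₂ ℕ._+_ (count-split {n} _ _) (count-split {n} _ _))
    (ℕ+-interchange (count {n} (λ x → p (true ∷ x) ∧ q (true ∷ x))) _ _ _)

  count+count-not : ∀ {n} (p : Input n → Bool) → count p ℕ.+ count (λ x → not (p x)) ≡ 2 ℕ.^ n
  count+count-not {n} p = trans (sym (count-split (λ _ → true) p)) (count-all n)

  count-witness : ∀ {n} (p : Input n → Bool) → count p ≢ 0 → ∃ λ x → p x ≡ true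
  count-witness {zero} p count≢0 with p [] in p[]
  ... | true  = [] , p[]
  ... | false = ⊥-elim (count≢0 refl)
  count-witness {suc n} p count≢0 with count (λ x → p (true ∷ x)) ℕ.≟ 0
  ... | no  c≢0 = let x , px = count-witness _ c≢0 in true ∷ x , px
  ... | yes c≡0 = let x , px = count-witness _ (λ c′≡0 → count≢0 (cong₂ ℕ._+_ c≡0 c′≡0)) in false ∷ x , px

  count-nonZero : ∀ {n} (p : Input n → Bool) x → p x ≡ true → count p ≢ 0
  count-nonZero p [] px rewrite px = λ ()
  count-nonZero p (true ∷ x) px c≡0 = count-nonZero _ x px (ℕ.m+n≡0⇒m≡0 _ c≡0)
  count-nonZero p (false ∷ x) px c≡0 = count-nonZero _ x px (ℕ.m+n≡0⇒n≡0 _ c≡0)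

  bitAt : ∀ {m} → Vec Bool m → ℕ → Bool
  bitAt []      _       = false
  bitAt (b ∷ x) zero    = b
  bitAt (b ∷ x) (suc i) = bitAt x i

  flipAt : ∀ {m} → ℕ → Vec Bool m → Vec Bool m
  flipAt _       []      = []
  flipAt zero    (b ∷ x) = not b ∷ x
  flipAt (suc k) (b ∷ x) = b ∷ flipAt k x

  bitAt-flipAt-≢ : ∀ {m} k j (x : Vec Bool m) → j ≢ k → bitAt (flipAt k x) j ≡ bitAt x j
  bitAt-flipAt-≢ k       j       []      j≢k = refl
  bitAt-flipAt-≢ zero    zero    (b ∷ x) j≢k = ⊥-elim (j≢k refl)
  bitAt-flipAt-≢ zero    (suc j) (b ∷ x) j≢k = refl
  bitAt-flipAt-≢ (suc k) zero    (b ∷ x) j≢k = refl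
  bitAt-flipAt-≢ (suc k) (suc j) (b ∷ x) j≢k = bitAt-flipAt-≢ k j x (j≢k ∘ cong suc)

  bitAt-flipAt-≡ : ∀ {m} k (x : Vec Bool m) → k ℕ.< m → bitAt (flipAt k x) k ≡ not (bitAt x k)
  bitAt-flipAt-≡ zero    (b ∷ x) _         = refl
  bitAt-flipAt-≡ (suc k) (b ∷ x) (s≤s k<m) = bitAt-flipAt-≡ k x k<m

  count-flipAt : ∀ {n} k (p : Input n → Bool) → count (λ x → p (flipAt k x)) ≡ count p
  count-flipAt {zero}  k       p = refl
  count-flipAt {suc n} zero    p = ℕ.+-comm (count {n} (λ x → p (false ∷ x))) _
  count-flipAt {suc n} (suc k) p = cong₂ ℕ._+_ (count-flipAt {n} k _) (count-flipAt {n} k _)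

  reads : ∀ {n} → ℕ → Bool → Input n → Bool
  reads i b x = does (bitAt x i Bool.≟ b)

  count-reads-half : ∀ {n} i b (p : Input n → Bool) → i ℕ.< n → (∀ x → p (flipAt i x) ≡ p x) →
                     count (λ x → p x ∧ reads i b x) ℕ.+ count (λ x → p x ∧ reads i b x) ≡ count p
  count-reads-half i b p i<n p-flip-invariant = sym (begin
    count p
      ≡⟨ count-split p (reads i b) ⟩
    count (λ x → p x ∧ reads i b x) ℕ.+ count (λ x → p x ∧ not (reads i b x))
      ≡⟨ cong (count (λ x → p x ∧ reads i b x) ℕ.+_) (count-cong flipped) ⟩
    count (λ x → p x ∧ reads i b x) ℕ.+ count (λ x → p (flipAt i x) ∧ reads i b (flipAt i x))
      ≡⟨ cong (count (λ x → p x ∧ reads i b x) ℕ.+_) (count-flipAt i (λ x → p x ∧ reads i b x)) ⟩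
    count (λ x → p x ∧ reads i b x) ℕ.+ count (λ x → p x ∧ reads i b x) ∎)
    where
    open ≡-Reasoning
    not-reads : ∀ a c → not (does (a Bool.≟ c)) ≡ does (not a Bool.≟ c)
    not-reads true  true  = refl
    not-reads true  false = refl
    not-reads false true  = refl
    not-reads false false = refl
    flipped : ∀ x → p x ∧ not (reads i b x) ≡ p (flipAt i x) ∧ reads i b (flipAt i x)
    flipped x = cong₂ _∧_ (sym (p-flip-invariant x))
      (trans (not-reads (bitAt x i) b) (cong (λ a → does (a Bool.≟ b)) (sym (bitAt-flipAt-≡ i x i<n))))

  wsum-++ : ∀ {X : Set} (wt : X → ℚ) xs ys p → wsum wt (xs ++ ys) p ≡ wsum wt xs p + wsum wt ys p
  wsum-++ wt []       ys p = sym (+-identityˡ _)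
  wsum-++ wt (x ∷ xs) ys p = trans (cong (wt x * indicator (p x) +_) (wsum-++ wt xs ys p))
                                   (sym (+-assoc (wt x * indicator (p x)) (wsum wt xs p) (wsum wt ys p)))

  wsum-map : ∀ {X Y : Set} (wt : Y → ℚ) (f : X → Y) xs p → wsum wt (map f xs) p ≡ wsum (wt ∘ f) xs (p ∘ f)
  wsum-map wt f []       p = refl
  wsum-map wt f (x ∷ xs) p = cong (wt (f x) * indicator (p (f x)) +_) (wsum-map wt f xs p)

  wsum-const : ∀ {n} c (p : Input n → Bool) → wsum (λ _ → c) (allInputs n) p ≡ c * ℕtoℚ (count p)
  wsum-const {zero}  c p = trans (+-identityʳ (c * indicator (p []))) (cong (c *_) (indicator≡ℕtoℚ (p [])))
    where
    indicator≡ℕtoℚ : ∀ b → indicator b ≡ ℕtoℚ (indicatorℕ b)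
    indicator≡ℕtoℚ true  = refl
    indicator≡ℕtoℚ false = refl
  wsum-const {suc n} c p = begin
    wsum (λ _ → c) (map (true ∷_) (allInputs n) ++ map (false ∷_) (allInputs n)) p
      ≡⟨ wsum-++ (λ _ → c) (map (true ∷_) (allInputs n)) _ p ⟩
    wsum (λ _ → c) (map (true ∷_) (allInputs n)) p + wsum (λ _ → c) (map (false ∷_) (allInputs n)) p
      ≡⟨ cong₂ _+_ (wsum-map (λ _ → c) (true ∷_) (allInputs n) p) (wsum-map (λ _ → c) (false ∷_) (allInputs n) p) ⟩
    wsum (λ _ → c) (allInputs n) (λ x → p (true ∷ x)) + wsum (λ _ → c) (allInputs n) (λ x → p (false ∷ x))
      ≡⟨ cong₂ _+_ (wsum-const {n} c _) (wsum-const {n} c _) ⟩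
    c * ℕtoℚ #true + c * ℕtoℚ #false
      ≡⟨ sym (*-distribˡ-+ c (ℕtoℚ #true) (ℕtoℚ #false)) ⟩
    c * (ℕtoℚ #true + ℕtoℚ #false)
      ≡⟨ cong (c *_) (sym (ℕtoℚ-+ #true #false)) ⟩
    c * ℕtoℚ (count p) ∎
    where
    open ≡-Reasoning
    #true #false : ℕ
    #true  = count {n} (λ x → p (true ∷ x))
    #false = count {n} (λ x → p (false ∷ x))

  opaque
    frac : ℕ → ℕ → ℚ
    frac n c = ℕtoℚ c * half^ n

    PrU≡frac-count : ∀ {n} (f : Input n → Bool) → PrU f ≡ frac n (count f)
    PrU≡frac-count {n} f = trans (wsum-const (half^ n) f) (*-comm (half^ n) _)

    frac-+ : ∀ n a b → frac n (a ℕ.+ b) ≡ frac n a + frac n b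
    frac-+ n a b = trans (cong (_* half^ n) (ℕtoℚ-+ a b)) (*-distribʳ-+ (half^ n) (ℕtoℚ a) (ℕtoℚ b))

    frac-mono-≤ : ∀ n {a b} → a ℕ.≤ b → frac n a ≤ frac n b
    frac-mono-≤ n a≤b = *-monoʳ-≤-nonNeg (half^ n) {{nonNegative (half^-nonNeg n)}} (ℕtoℚ-mono-≤ a≤b)

    frac-zero : ∀ n → frac n 0 ≡ 0ℚ
    frac-zero n = *-zeroˡ (half^ n)

    frac-all : ∀ n → frac n (2 ℕ.^ n) ≡ 1ℚ
    frac-all n = trans (*-comm (ℕtoℚ (2 ℕ.^ n)) (half^ n)) (half^*2^≡1 n)

  PrU≤1 : ∀ {n} (f : Input n → Bool) → PrU f ≤ 1ℚ
  PrU≤1 {n} f = begin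
    PrU f                    ≡⟨ PrU≡frac-count f ⟩
    frac n (count f)         ≤⟨ frac-mono-≤ n (count-mono {p = f} {q = λ _ → true} (λ _ _ → refl)) ⟩
    frac n (count {n} (λ _ → true)) ≡⟨ cong (frac n) (count-all n) ⟩
    frac n (2 ℕ.^ n)         ≡⟨ frac-all n ⟩
    1ℚ                       ∎
    where open ≤-Reasoning

  PrU-nonNeg : ∀ {n} (f : Input n → Bool) → 0ℚ ≤ PrU f
  PrU-nonNeg {n} f = wsum-nonNeg (λ _ → half^-nonNeg n) (allInputs n) f

  PrD-nonNeg : ∀ {n} (D : Distribution n) f → 0ℚ ≤ PrD D f
  PrD-nonNeg {n} D f = wsum-nonNeg (mass-nonneg D) (allInputs n) f

  PrD≤1 : ∀ {n} (D : Distribution n) f → PrD D f ≤ 1ℚ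
  PrD≤1 {n} D f = ≤-trans (wsum≤total (mass-nonneg D) (allInputs n) f) (≤-reflexive (mass-sum D))

  opaque
    thr : ℚ → ℕ → ℚ
    thr δ a = ℕtoℚ (2 ℕ.^ a) * δ

    thr-def : ∀ δ a → thr δ a ≡ ℕtoℚ (2 ℕ.^ a) * δ
    thr-def δ a = refl

    thr-suc : ∀ δ a → thr δ (suc a) ≡ thr δ a + thr δ a
    thr-suc δ a = trans (cong (_* δ) (trans (cong ℕtoℚ (cong (2 ℕ.^ a ℕ.+_) (ℕ.+-identityʳ (2 ℕ.^ a))))
      (ℕtoℚ-+ (2 ℕ.^ a) (2 ℕ.^ a)))) (*-distribʳ-+ δ (ℕtoℚ (2 ℕ.^ a)) (ℕtoℚ (2 ℕ.^ a)))

    thr-zero : ∀ δ → thr δ 0 ≡ δ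
    thr-zero δ = *-identityˡ δ

    thr≤1 : ∀ δ a → δ ≤ half^ a → thr δ a ≤ 1ℚ
    thr≤1 δ a δ≤half^a = ≤-trans
      (*-monoˡ-≤-nonNeg (ℕtoℚ (2 ℕ.^ a)) {{nonNegative (ℕtoℚ-nonNeg (2 ℕ.^ a))}} δ≤half^a)
      (≤-reflexive (trans (*-comm (ℕtoℚ (2 ℕ.^ a)) (half^ a)) (half^*2^≡1 a)))

    thr-mono-≤ : ∀ {δ} → 0ℚ ≤ δ → ∀ {a b} → a ℕ.≤ b → thr δ a ≤ thr δ b
    thr-mono-≤ {δ} δ≥0 a≤b = *-monoʳ-≤-nonNeg δ {{nonNegative δ≥0}} (ℕtoℚ-mono-≤ (ℕ.^-monoʳ-≤ 2 a≤b))

  thr-pred : ∀ δ {w} → Fin w → thr δ (w ∸ 1) + thr δ (w ∸ 1) ≡ thr δ w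
  thr-pred δ {suc w} _ = sym (thr-suc δ w)

  module _ {δ : ℚ} (δ≥0 : 0ℚ ≤ δ) where

    δ≤thr : ∀ a → δ ≤ thr δ a
    δ≤thr a = subst (_≤ thr δ a) (thr-zero δ) (thr-mono-≤ δ≥0 {0} {a} z≤n)

    thr-nonNeg : ∀ a → 0ℚ ≤ thr δ a
    thr-nonNeg a = ≤-trans δ≥0 (δ≤thr a)

    3δ≤thr : ∀ {a} → 2 ℕ.≤ a → δ + δ + δ ≤ thr δ a
    3δ≤thr {a} 2≤a = begin
      δ + δ + δ                  ≤⟨ +-monoʳ-≤ (δ + δ) (subst (_≤ δ + δ) (+-identityʳ δ) (+-monoʳ-≤ δ δ≥0)) ⟩
      δ + δ + (δ + δ)            ≡⟨ sym (cong₂ (λ a b → a + a + (b + b)) (thr-zero δ) (thr-zero δ)) ⟩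
      thr δ 0 + thr δ 0 + (thr δ 0 + thr δ 0) ≡⟨ sym (trans (thr-suc δ 1) (cong₂ _+_ (thr-suc δ 0) (thr-suc δ 0))) ⟩
      thr δ 2                    ≤⟨ thr-mono-≤ δ≥0 2≤a ⟩
      thr δ a                    ∎
      where open ≤-Reasoning

  bias : ∀ {n} → Distribution n → (Input n → Bool) → ℚ
  bias D f = ∣ PrD D f - PrU f ∣

  bias-nonNeg : ∀ {n} (D : Distribution n) f → 0ℚ ≤ bias D f
  bias-nonNeg D f = 0≤∣p∣ _

  bias≤⇒PrD≤ : ∀ {n} (D : Distribution n) {ε f} → bias D f ≤ ε → PrD D f ≤ PrU f + ε
  bias≤⇒PrD≤ D = ∣p-q∣≤r⇒p≤q+r

  bias-cong : ∀ {n} (D : Distribution n) {f g : Input n → Bool} → (∀ x → f x ≡ g x) → bias D f ≡ bias D g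
  bias-cong {n} D f≗g = cong₂ (λ a b → ∣ a - b ∣) (wsum-cong (mass D) (allInputs n) f≗g)
                                                   (wsum-cong (λ _ → half^ n) (allInputs n) f≗g)

  bias≤1 : ∀ {n} (D : Distribution n) f → bias D f ≤ 1ℚ
  bias≤1 D f = ∣p-q∣≤r (≤-trans (PrD≤1 D f) (+-monoˡ-≤ 1ℚ (PrU-nonNeg f)))
                       (≤-trans (PrU≤1 f) (+-monoˡ-≤ 1ℚ (PrD-nonNeg D f)))

  bias-agree : ∀ {n} (D : Distribution n) {f f′ h : Input n → Bool} → (∀ x → h x ≡ false → f x ≡ f′ x) →
               bias D f ≤ bias D f′ + (PrD D h + PrU h)
  bias-agree {n} D {f} {f′} {h} agree =
    ≤-trans (∣p-q∣≤∣r-s∣+∣p-r∣+∣q-s∣ (PrD D f) (PrU f) (PrD D f′) (PrU f′))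
    (+-monoʳ-≤ (bias D f′) (+-mono-≤ (wsum-agree (mass-nonneg D) (allInputs n) agree)
                                     (wsum-agree (λ _ → half^-nonNeg n) (allInputs n) agree)))

  Layers : ℕ → Set
  Layers w = ℕ → Layer w

  run : ∀ {w n} → Layers w → Fin w → ℕ → Input n → Fin w
  run g s zero    x = s
  run g s (suc i) x = g i (run g s i x) (bitAt x i)

  run-suc-∷ : ∀ {w n} (g : Layers w) s i b (x : Input n) →
              run g s (suc i) (b ∷ x) ≡ run (g ∘ suc) (g 0 s b) i x
  run-suc-∷ g s zero    b x = refl
  run-suc-∷ g s (suc i) b x = cong (λ u → g (suc i) u (bitAt x i)) (run-suc-∷ g s i b x)

  run-cong : ∀ {w n} {g g′ : Layers w} s i (x : Input n) →
             (∀ j → j ℕ.< i → ∀ u b → g j u b ≡ g′ j u b) → run g s i x ≡ run g′ s i x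
  run-cong s zero    x g≗g′ = refl
  run-cong {g = g} {g′} s (suc i) x g≗g′ =
    trans (cong (λ u → g i u (bitAt x i)) (run-cong s i x (λ j j<i → g≗g′ j (ℕ.m<n⇒m<1+n j<i))))
          (g≗g′ i ℕ.≤-refl _ _)

  run-cong-from : ∀ {w n} {g g′ : Layers w} s i (x : Input n) → run g s i x ≡ run g′ s i x →
                  (∀ j → i ℕ.≤ j → ∀ u b → g j u b ≡ g′ j u b) →
                  ∀ d → run g s (d ℕ.+ i) x ≡ run g′ s (d ℕ.+ i) x
  run-cong-from s i x agree g≗g′ zero    = agree
  run-cong-from {g = g} s i x agree g≗g′ (suc d) =
    trans (cong (λ u → g (d ℕ.+ i) u (bitAt x (d ℕ.+ i))) (run-cong-from s i x agree g≗g′ d))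
          (g≗g′ (d ℕ.+ i) (ℕ.m≤n+m i d) _ _)

  run-bits : ∀ {w n} (g : Layers w) s i (x y : Input n) →
             (∀ j → j ℕ.< i → bitAt x j ≡ bitAt y j) → run g s i x ≡ run g s i y
  run-bits g s zero    x y x≈y = refl
  run-bits g s (suc i) x y x≈y =
    cong₂ (g i) (run-bits g s i x y (λ j j<i → x≈y j (ℕ.m<n⇒m<1+n j<i))) (x≈y i ℕ.≤-refl)

  run-flipAt : ∀ {w n} (g : Layers w) s i (x : Input n) → run g s i (flipAt i x) ≡ run g s i x
  run-flipAt g s i x = run-bits g s i (flipAt i x) x (λ j j<i → bitAt-flipAt-≢ i j x (ℕ.<⇒≢ j<i))

  lookupLayer : ∀ {w m} → Vec (Layer w) m → Layers w
  lookupLayer []      _       u b = u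
  lookupLayer (f ∷ v) zero    = f
  lookupLayer (f ∷ v) (suc i) = lookupLayer v i

  runPrefix≡run : ∀ {w m} (v : Vec (Layer w) m) i (x : Input m) s → i ℕ.≤ m →
                  runPrefix i v x s ≡ run (lookupLayer v) s i x
  runPrefix≡run v       zero    x       s _         = refl
  runPrefix≡run (f ∷ v) (suc i) (b ∷ x) s (s≤s i≤m) =
    trans (runPrefix≡run v i x (f s b) i≤m) (sym (run-suc-∷ (lookupLayer (f ∷ v)) s i b x))

  toVec : ∀ {w} → Layers w → (m : ℕ) → Vec (Layer w) m
  toVec g zero    = []
  toVec g (suc m) = g 0 ∷ toVec (g ∘ suc) m

  lookupLayer-toVec : ∀ {w} (g : Layers w) m j → j ℕ.< m → ∀ u b → lookupLayer (toVec g m) j u b ≡ g j u b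
  lookupLayer-toVec g (suc m) zero    _         u b = refl
  lookupLayer-toVec g (suc m) (suc j) (s≤s j<m) u b = lookupLayer-toVec (g ∘ suc) m j j<m u b

  runPrefix-toVec : ∀ {w m} (g : Layers w) i (x : Input m) s → i ℕ.≤ m → runPrefix i (toVec g m) x s ≡ run g s i x
  runPrefix-toVec {m = m} g i x s i≤m = trans (runPrefix≡run (toVec g m) i x s i≤m)
    (run-cong s i x (λ j j<i → lookupLayer-toVec g m j (ℕ.<-≤-trans j<i i≤m)))

  visits : ∀ {w} n → Layers w → Fin w → ℕ → Fin w → ℕ
  visits n g s i v = count {n} (λ x → run g s i x == v)

  visits-nonZero : ∀ {w n} (g : Layers w) s i (x : Input n) → visits n g s i (run g s i x) ≢ 0
  visits-nonZero g s i x = count-nonZero (λ y → run g s i y == run g s i x) x (==-refl (run g s i x))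

  mkROBP : ∀ {n w} → Layers w → Fin w → (Fin w → Bool) → ROBP n w
  mkROBP {n} g s acc = record { start = s ; layers = toVec g n ; accept = acc }

  eval-mkROBP : ∀ {n w} (g : Layers w) s acc (x : Input n) → eval (mkROBP g s acc) x ≡ acc (run g s n x)
  eval-mkROBP {n} g s acc x = cong acc (runPrefix-toVec g n x s ℕ.≤-refl)

  reachable-mkROBP : ∀ {n w} δ (g : Layers w) s acc →
    (∀ i → i ℕ.≤ n → ∀ v → visits n g s i v ≢ 0 → δ ≤ frac n (visits n g s i v)) →
    Reachable δ (mkROBP {n} g s acc)
  reachable-mkROBP {n} δ g s acc visited⇒δ≤ i v 0<p = subst (δ ≤_) (sym p≡frac) (visited⇒δ≤ (toℕ i) i≤n v visited)
    where
    i≤n : toℕ i ℕ.≤ n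
    i≤n = ℕ.s≤s⁻¹ (Fin.toℕ<n i)
    p≡frac : reachProb (mkROBP g s acc) i v ≡ frac n (visits n g s (toℕ i) v)
    p≡frac = trans (PrU≡frac-count _)
      (cong (frac n) (count-cong (λ x → cong (_== v) (runPrefix-toVec g (toℕ i) x s i≤n))))
    visited : visits n g s (toℕ i) v ≢ 0
    visited c≡0 = <-irrefl (sym (trans p≡frac (trans (cong (frac n) c≡0) (frac-zero n)))) 0<p

  countᶠ : ∀ {w} → (Fin w → Bool) → ℕ
  countᶠ {zero}  p = 0
  countᶠ {suc w} p = indicatorℕ (p Fin.zero) ℕ.+ countᶠ (p ∘ Fin.suc)

  countᶠ≤ : ∀ {w} (p : Fin w → Bool) → countᶠ p ℕ.≤ w
  countᶠ≤ {zero}  p = z≤n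
  countᶠ≤ {suc w} p = ℕ.+-mono-≤ (indicatorℕ≤1 (p Fin.zero)) (countᶠ≤ (p ∘ Fin.suc))

  countᶠ-nonZero : ∀ {w} (p : Fin w → Bool) v → p v ≡ true → 1 ℕ.≤ countᶠ p
  countᶠ-nonZero p Fin.zero    pv rewrite pv = s≤s z≤n
  countᶠ-nonZero p (Fin.suc v) pv = ℕ.≤-trans (countᶠ-nonZero (p ∘ Fin.suc) v pv) (ℕ.m≤n+m _ _)

  countᶠ-cong : ∀ {w} {p q : Fin w → Bool} → (∀ v → p v ≡ q v) → countᶠ p ≡ countᶠ q
  countᶠ-cong {zero}  p≗q = refl
  countᶠ-cong {suc w} p≗q = cong₂ ℕ._+_ (cong indicatorℕ (p≗q Fin.zero)) (countᶠ-cong (p≗q ∘ Fin.suc))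

  countᶠ-remove : ∀ {w} (q : Fin w → Bool) v → countᶠ q ≡ indicatorℕ (q v) ℕ.+ countᶠ (λ u → q u ∧ not (u == v))
  countᶠ-remove {suc w} q Fin.zero rewrite Bool.∧-zeroʳ (q Fin.zero) =
    cong (indicatorℕ (q Fin.zero) ℕ.+_) (countᶠ-cong (λ u → sym (Bool.∧-identityʳ (q (Fin.suc u)))))
  countᶠ-remove {suc w} q (Fin.suc v) = begin
    indicatorℕ (q Fin.zero) ℕ.+ countᶠ (q ∘ Fin.suc)
      ≡⟨ cong (indicatorℕ (q Fin.zero) ℕ.+_) (countᶠ-remove (q ∘ Fin.suc) v) ⟩
    indicatorℕ (q Fin.zero) ℕ.+ (indicatorℕ (q (Fin.suc v)) ℕ.+ countᶠ (λ u → q (Fin.suc u) ∧ not (u == v)))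
      ≡⟨ ℕ+-exchange (indicatorℕ (q Fin.zero)) (indicatorℕ (q (Fin.suc v))) _ ⟩
    indicatorℕ (q (Fin.suc v)) ℕ.+ (indicatorℕ (q Fin.zero) ℕ.+ countᶠ (λ u → q (Fin.suc u) ∧ not (u == v)))
      ≡⟨ cong (λ b → indicatorℕ (q (Fin.suc v)) ℕ.+ (indicatorℕ b ℕ.+ countᶠ (λ u → q (Fin.suc u) ∧ not (u == v))))
              (sym (Bool.∧-identityʳ (q Fin.zero))) ⟩
    indicatorℕ (q (Fin.suc v)) ℕ.+ countᶠ (λ u → q u ∧ not (u == Fin.suc v))
      ∎
    where open ≡-Reasoning

  countᶠ-injection : ∀ {m k} (σ : Fin m → Fin k) → Injective _≡_ _≡_ σ →
                     (p : Fin m → Bool) (q : Fin k → Bool) → (∀ u → p u ≡ true → q (σ u) ≡ true) →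
                     countᶠ p ℕ.≤ countᶠ q
  countᶠ-injection {zero}  σ σ-inj p q p⊆q∘σ = z≤n
  countᶠ-injection {suc m} σ σ-inj p q p⊆q∘σ = begin
    indicatorℕ (p Fin.zero) ℕ.+ countᶠ (p ∘ Fin.suc)
      ≤⟨ ℕ.+-mono-≤ (indicatorℕ-mono (p⊆q∘σ Fin.zero))
           (countᶠ-injection (σ ∘ Fin.suc) (Fin.suc-injective ∘ σ-inj) (p ∘ Fin.suc) q′ p∘suc⊆q′) ⟩
    indicatorℕ (q (σ Fin.zero)) ℕ.+ countᶠ q′
      ≡⟨ sym (countᶠ-remove q (σ Fin.zero)) ⟩
    countᶠ q ∎
    where
    open ℕ.≤-Reasoning
    q′ : Fin _ → Bool
    q′ v = q v ∧ not (v == σ Fin.zero)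
    indicatorℕ-mono : ∀ {a b} → (a ≡ true → b ≡ true) → indicatorℕ a ℕ.≤ indicatorℕ b
    indicatorℕ-mono {true}  a⇒b rewrite a⇒b refl = ℕ.≤-refl
    indicatorℕ-mono {false} a⇒b = z≤n
    p∘suc⊆q′ : ∀ u → p (Fin.suc u) ≡ true → q′ (σ (Fin.suc u)) ≡ true
    p∘suc⊆q′ u pu
      rewrite p⊆q∘σ (Fin.suc u) pu | ≢⇒==false (Fin.0≢1+n ∘ sym ∘ σ-inj {Fin.suc u} {Fin.zero}) = refl

  countᶠ-injection-missing : ∀ {m k} (σ : Fin m → Fin k) → Injective _≡_ _≡_ σ →
                             (p : Fin m → Bool) (q : Fin k → Bool) → (∀ u → p u ≡ true → q (σ u) ≡ true) →
                             ∀ v → q v ≡ true → (∀ u → p u ≡ true → σ u ≢ v) → suc (countᶠ p) ℕ.≤ countᶠ q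
  countᶠ-injection-missing σ σ-inj p q p⊆q∘σ v qv v∉σ[p] = begin
    suc (countᶠ p)   ≤⟨ s≤s (countᶠ-injection σ σ-inj p q′ p⊆q′∘σ) ⟩
    suc (countᶠ q′)  ≡⟨ cong (λ b → indicatorℕ b ℕ.+ countᶠ q′) (sym qv) ⟩
    indicatorℕ (q v) ℕ.+ countᶠ q′  ≡⟨ sym (countᶠ-remove q v) ⟩
    countᶠ q ∎
    where
    open ℕ.≤-Reasoning
    q′ : Fin _ → Bool
    q′ u = q u ∧ not (u == v)
    p⊆q′∘σ : ∀ u → p u ≡ true → q′ (σ u) ≡ true
    p⊆q′∘σ u pu rewrite p⊆q∘σ u pu | ≢⇒==false (v∉σ[p] u pu) = refl

  countBelow : ℕ → (ℕ → Bool) → ℕ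
  countBelow zero    p = 0
  countBelow (suc m) p = countBelow m p ℕ.+ indicatorℕ (p m)

  countBelow-none : ∀ m p → (∀ k → k ℕ.< m → p k ≡ false) → countBelow m p ≡ 0
  countBelow-none zero    p none = refl
  countBelow-none (suc m) p none rewrite none m ℕ.≤-refl =
    trans (ℕ.+-identityʳ _) (countBelow-none m p (λ k k<m → none k (ℕ.m<n⇒m<1+n k<m)))

  countBelow-≡ : ∀ c m → countBelow m (λ k → does (c ℕ.≟ k)) ℕ.≤ 1
  countBelow-≡ c zero    = z≤n
  countBelow-≡ c (suc m) with c ℕ.<? m
  ... | yes c<m rewrite dec-false (c ℕ.≟ m) (ℕ.<⇒≢ c<m) =
    ℕ.≤-trans (ℕ.≤-reflexive (ℕ.+-identityʳ _)) (countBelow-≡ c m)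
  ... | no c≮m = subst (λ t → t ℕ.+ indicatorℕ (does (c ℕ.≟ m)) ℕ.≤ 1) (sym (countBelow-none m _ unseen))
                       (indicatorℕ≤1 (does (c ℕ.≟ m)))
    where
    unseen : ∀ k → k ℕ.< m → does (c ℕ.≟ k) ≡ false
    unseen k k<m = dec-false (c ℕ.≟ k) (λ { refl → c≮m k<m })

  countBelow-∨ : ∀ m p q → countBelow m (λ k → p k ∨ q k) ℕ.≤ countBelow m p ℕ.+ countBelow m q
  countBelow-∨ zero    p q = z≤n
  countBelow-∨ (suc m) p q = ℕ.≤-trans (ℕ.+-mono-≤ (countBelow-∨ m p q) (indicatorℕ-∨ (p m) (q m)))
    (ℕ.≤-reflexive (ℕ+-interchange (countBelow m p) (countBelow m q) (indicatorℕ (p m)) (indicatorℕ (q m))))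
    where
    indicatorℕ-∨ : ∀ a b → indicatorℕ (a ∨ b) ℕ.≤ indicatorℕ a ℕ.+ indicatorℕ b
    indicatorℕ-∨ true  b = s≤s z≤n
    indicatorℕ-∨ false b = ℕ.≤-refl

  listed : ∀ {n} → List (Fin n) → ℕ → Bool
  listed L k = any (λ j → does (toℕ j ℕ.≟ k)) L

  ∈⇒listed : ∀ {n} {j : Fin n} {L} → j ∈ L → listed L (toℕ j) ≡ true
  ∈⇒listed {j = j} (here refl) rewrite dec-true (toℕ j ℕ.≟ toℕ j) refl = refl
  ∈⇒listed {L = i ∷ L} (there j∈L) rewrite ∈⇒listed j∈L = Bool.∨-zeroʳ _

  countBelow-listed : ∀ {n} m (L : List (Fin n)) → countBelow m (listed L) ℕ.≤ length L
  countBelow-listed {n} m []  = ℕ.≤-reflexive (countBelow-none m (listed {n} []) (λ _ _ → refl))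
  countBelow-listed m (j ∷ L) = ℕ.≤-trans (countBelow-∨ m (λ k → does (toℕ j ℕ.≟ k)) (listed L))
    (ℕ.+-mono-≤ (countBelow-≡ (toℕ j) m) (countBelow-listed m L))

  -- The reachability invariant

  isNonZero : ℕ → Bool
  isNonZero zero    = false
  isNonZero (suc _) = true

  ≢0⇒isNonZero : ∀ {c} → c ≢ 0 → isNonZero c ≡ true
  ≢0⇒isNonZero {zero}  c≢0 = ⊥-elim (c≢0 refl)
  ≢0⇒isNonZero {suc c} c≢0 = refl

  isNonZero⇒≢0 : ∀ {c} → isNonZero c ≡ true → c ≢ 0
  isNonZero⇒≢0 {suc c} _ ()

  support : ∀ {w} → (Fin w → ℕ) → ℕ
  support c = countᶠ (isNonZero ∘ c)

  Heavy : ∀ {w} → ℕ → ℚ → (Fin w → ℕ) → Set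
  Heavy {w} n δ c = ∀ v → c v ≢ 0 → thr δ (w ∸ support c) ≤ frac n (c v)

  Heavy-cong : ∀ {w n δ} {c c′ : Fin w → ℕ} → (∀ v → c v ≡ c′ v) → Heavy n δ c → Heavy n δ c′
  Heavy-cong {w} {n} {δ} c≗c′ heavy v c′v≢0 =
    subst₂ (λ a b → thr δ (w ∸ a) ≤ frac n b) (countᶠ-cong (cong isNonZero ∘ c≗c′)) (c≗c′ v)
      (heavy v (c′v≢0 ∘ trans (sym (c≗c′ v))))

  Heavy⇒δ≤ : ∀ {w n δ} {c : Fin w → ℕ} → 0ℚ ≤ δ → Heavy n δ c → ∀ v → c v ≢ 0 → δ ≤ frac n (c v)
  Heavy⇒δ≤ {w} {δ = δ} {c} δ≥0 heavy v cv≢0 = ≤-trans (δ≤thr δ≥0 (w ∸ support c)) (heavy v cv≢0)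

  NonColliding : ∀ {w} → Layer w → Set
  NonColliding L = ∀ b → Injective _≡_ _≡_ (λ u → L u b)

  Heavy-step : ∀ {w n δ} → 0ℚ ≤ δ → (c c′ : Fin w → ℕ) (L : Layer w) →
    NonColliding L →
    (∀ u b → c u ≢ 0 → c′ (L u b) ≢ 0) →
    (∀ v → c′ v ≢ 0 → ∃ λ u → ∃ λ b → L u b ≡ v × c u ≢ 0 × c u ℕ.≤ c′ v ℕ.+ c′ v) →
    (∀ v u b u′ → L u b ≡ v → L u′ (not b) ≡ v → c u ℕ.+ c u′ ℕ.≤ c′ v ℕ.+ c′ v) →
    Heavy n δ c → Heavy n δ c′
  -- A vertex entered along both labels has at least the average probability of its two
  -- predecessors; a vertex entered along one label only makes the support grow, which halves
  -- the threshold.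
  Heavy-step {w} {n} {δ} δ≥0 c c′ L L-nonColliding visited⇒visited has-pred two-preds heavy v v-visited
    with has-pred v v-visited
  ... | u , b , Lub≡v , u-visited , cu≤2c′v
    with Fin.any? (λ u′ → (L u′ (not b) Fin.≟ v) ×-dec ¬? (c u′ ℕ.≟ 0))
  ... | yes (u′ , Lu′b̄≡v , u′-visited) = double-cancel-≤ (begin
    thr δ (w ∸ support c′) + thr δ (w ∸ support c′)
      ≤⟨ +-mono-≤ (thr-mono-≤ δ≥0 support-grows) (thr-mono-≤ δ≥0 support-grows) ⟩
    thr δ (w ∸ support c) + thr δ (w ∸ support c)
      ≤⟨ +-mono-≤ (heavy u u-visited) (heavy u′ u′-visited) ⟩
    frac n (c u) + frac n (c u′)
      ≡⟨ sym (frac-+ n (c u) (c u′)) ⟩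
    frac n (c u ℕ.+ c u′)
      ≤⟨ frac-mono-≤ n (two-preds v u b u′ Lub≡v Lu′b̄≡v) ⟩
    frac n (c′ v ℕ.+ c′ v)
      ≡⟨ frac-+ n (c′ v) (c′ v) ⟩
    frac n (c′ v) + frac n (c′ v) ∎)
    where
    open ≤-Reasoning
    support-grows : w ∸ support c′ ℕ.≤ w ∸ support c
    support-grows = ℕ.∸-monoʳ-≤ w (countᶠ-injection (λ z → L z b) (L-nonColliding b) (isNonZero ∘ c) (isNonZero ∘ c′)
      (λ z cz → ≢0⇒isNonZero (visited⇒visited z b (isNonZero⇒≢0 cz))))
  ... | no no-other-pred = double-cancel-≤ (begin
    thr δ (w ∸ support c′) + thr δ (w ∸ support c′)
      ≡⟨ sym (thr-suc δ (w ∸ support c′)) ⟩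
    thr δ (suc (w ∸ support c′))
      ≤⟨ thr-mono-≤ δ≥0 support-grows-strictly ⟩
    thr δ (w ∸ support c)
      ≤⟨ heavy u u-visited ⟩
    frac n (c u)
      ≤⟨ frac-mono-≤ n cu≤2c′v ⟩
    frac n (c′ v ℕ.+ c′ v)
      ≡⟨ frac-+ n (c′ v) (c′ v) ⟩
    frac n (c′ v) + frac n (c′ v) ∎)
    where
    open ≤-Reasoning
    support-grows-strictly : suc (w ∸ support c′) ℕ.≤ w ∸ support c
    support-grows-strictly = ℕ.∸-monoʳ-<
      (countᶠ-injection-missing (λ z → L z (not b)) (L-nonColliding (not b)) (isNonZero ∘ c) (isNonZero ∘ c′)
        (λ z cz → ≢0⇒isNonZero (visited⇒visited z (not b) (isNonZero⇒≢0 cz)))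
        v (≢0⇒isNonZero v-visited)
        (λ z cz Lzb̄≡v → no-other-pred (z , Lzb̄≡v , isNonZero⇒≢0 cz)))
      (countᶠ≤ (isNonZero ∘ c′))

  inflow : ∀ {w} n → Layers w → Fin w → ℕ → Layer w → Fin w → ℕ
  inflow n g s i L v = count {n} (λ x → L (run g s i x) (bitAt x i) == v)

  edgeFlow : ∀ {w} n → Layers w → Fin w → ℕ → Fin w → Bool → ℕ
  edgeFlow n g s i u b = count {n} (λ x → (run g s i x == u) ∧ reads i b x)

  module _ {w n : ℕ} (g : Layers w) (s : Fin w) (i : ℕ) where

    edgeFlow-half : i ℕ.< n → ∀ u b → edgeFlow n g s i u b ℕ.+ edgeFlow n g s i u b ≡ visits n g s i u
    edgeFlow-half i<n u b =
      count-reads-half i b (λ x → run g s i x == u) i<n (λ x → cong (_== u) (run-flipAt g s i x))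

    on-edge : ∀ {u b} (x : Input n) → (run g s i x == u) ∧ reads i b x ≡ true → run g s i x ≡ u × bitAt x i ≡ b
    on-edge {u} {b} x at-u∧reads-b with bitAt x i Bool.≟ b | Bool.∧-conicalʳ (run g s i x == u) _ at-u∧reads-b
    ... | yes bit≡b | _ = ==⇒≡ (Bool.∧-conicalˡ _ _ at-u∧reads-b) , bit≡b

    edge-enters : ∀ (L : Layer w) {u b v} → L u b ≡ v → ∀ (x : Input n) →
                  (run g s i x == u) ∧ reads i b x ≡ true → L (run g s i x) (bitAt x i) == v ≡ true
    edge-enters L {v = v} Lub≡v x x-on-edge with on-edge x x-on-edge
    ... | refl , refl = subst (λ z → z == v ≡ true) (sym Lub≡v) (==-refl v)

    edgeFlow≤inflow : ∀ (L : Layer w) {u b v} → L u b ≡ v → edgeFlow n g s i u b ℕ.≤ inflow n g s i L v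
    edgeFlow≤inflow L Lub≡v = count-mono {n} (edge-enters L Lub≡v)

    edgeFlows≤inflow : ∀ (L : Layer w) {u b u′ b′ v} → L u b ≡ v → L u′ b′ ≡ v → (u ≡ u′ → b ≢ b′) →
                       edgeFlow n g s i u b ℕ.+ edgeFlow n g s i u′ b′ ℕ.≤ inflow n g s i L v
    edgeFlows≤inflow L {u} {b} {u′} {b′} Lub≡v Lu′b′≡v distinct =
      count-disjoint {n} disjoint (edge-enters L Lub≡v) (edge-enters L Lu′b′≡v)
      where
      disjoint : ∀ x → (run g s i x == u) ∧ reads i b x ≡ true → (run g s i x == u′) ∧ reads i b′ x ≡ true → ⊥
      disjoint x on-first on-second with on-edge x on-first | on-edge x on-second
      ... | at-u , reads-b | at-u′ , reads-b′ = distinct (trans (sym at-u) at-u′) (trans (sym reads-b) reads-b′)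

    inflow-witness : ∀ (L : Layer w) v → inflow n g s i L v ≢ 0 → ∃ λ (x : Input n) → L (run g s i x) (bitAt x i) ≡ v
    inflow-witness L v inflow≢0 = let x , enters = count-witness _ inflow≢0 in x , ==⇒≡ enters

    visits≤2·inflow : i ℕ.< n → ∀ (L : Layer w) {u b v} → L u b ≡ v →
                      visits n g s i u ℕ.≤ inflow n g s i L v ℕ.+ inflow n g s i L v
    visits≤2·inflow i<n L {u} {b} Lub≡v = subst (ℕ._≤ _) (edgeFlow-half i<n u b)
      (ℕ.+-mono-≤ (edgeFlow≤inflow L Lub≡v) (edgeFlow≤inflow L Lub≡v))

    visits+visits≤2·inflow : i ℕ.< n → ∀ (L : Layer w) {u b u′ b′ v} → L u b ≡ v → L u′ b′ ≡ v →
                             (u ≡ u′ → b ≢ b′) →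
                             visits n g s i u ℕ.+ visits n g s i u′ ℕ.≤ inflow n g s i L v ℕ.+ inflow n g s i L v
    visits+visits≤2·inflow i<n L {u} {b} {u′} {b′} {v} Lub≡v Lu′b′≡v distinct =
      subst₂ (λ a a′ → a ℕ.+ a′ ℕ.≤ _) (edgeFlow-half i<n u b) (edgeFlow-half i<n u′ b′)
        (ℕ.≤-trans (ℕ.≤-reflexive (ℕ+-interchange (edgeFlow n g s i u b) _ _ _))
                   (ℕ.+-mono-≤ both-edges both-edges))
      where
      both-edges : edgeFlow n g s i u b ℕ.+ edgeFlow n g s i u′ b′ ℕ.≤ inflow n g s i L v
      both-edges = edgeFlows≤inflow L Lub≡v Lu′b′≡v distinct

    Heavy-permutation : ∀ {δ} → 0ℚ ≤ δ → i ℕ.< n → (L : Layer w) → NonColliding L →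
                        Heavy n δ (visits n g s i) → Heavy n δ (inflow n g s i L)
    Heavy-permutation δ≥0 i<n L L-nonColliding =
      Heavy-step δ≥0 (visits n g s i) (inflow n g s i L) L L-nonColliding visited⇒visited has-pred two-preds
      where
      visited⇒visited : ∀ u b → visits n g s i u ≢ 0 → inflow n g s i L (L u b) ≢ 0
      visited⇒visited u b u-visited inflow≡0 =
        u-visited (ℕ.n≤0⇒n≡0 (subst (λ c → visits n g s i u ℕ.≤ c ℕ.+ c) inflow≡0 (visits≤2·inflow i<n L refl)))
      has-pred : ∀ v → inflow n g s i L v ≢ 0 → ∃ λ u → ∃ λ b → L u b ≡ v × visits n g s i u ≢ 0 ×
                 visits n g s i u ℕ.≤ inflow n g s i L v ℕ.+ inflow n g s i L v
      has-pred v v-visited = let x , enters = inflow-witness L v v-visited in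
        run g s i x , bitAt x i , enters , visits-nonZero g s i x , visits≤2·inflow i<n L enters
      two-preds : ∀ v u b u′ → L u b ≡ v → L u′ (not b) ≡ v →
                  visits n g s i u ℕ.+ visits n g s i u′ ℕ.≤ inflow n g s i L v ℕ.+ inflow n g s i L v
      two-preds v u b u′ Lub≡v Lu′b̄≡v = visits+visits≤2·inflow i<n L Lub≡v Lu′b̄≡v (λ _ → Bool.not-¬ refl)

    unique-predecessor : ∀ {δ} → 0ℚ ≤ δ → i ℕ.< n → Heavy n δ (visits n g s i) → (L : Layer w) → ∀ v →
      inflow n g s i L v ≢ 0 → frac n (inflow n g s i L v) < δ →
      ∃ λ u₀ → (∀ (x : Input n) → L (run g s i x) (bitAt x i) == v ≡ true → run g s i x ≡ u₀) ×
               visits n g s i u₀ ≢ 0 × visits n g s i u₀ ℕ.≤ inflow n g s i L v ℕ.+ inflow n g s i L v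
    unique-predecessor {δ} δ≥0 i<n heavy L v v-visited v-light with inflow-witness L v v-visited
    ... | x₀ , x₀-enters = run g s i x₀ , unique , visits-nonZero g s i x₀ , visits≤2·inflow i<n L x₀-enters
      where
      c : ℕ
      c = inflow n g s i L v
      unique : ∀ x → L (run g s i x) (bitAt x i) == v ≡ true → run g s i x ≡ run g s i x₀
      unique x x-enters with run g s i x Fin.≟ run g s i x₀
      ... | yes same = same
      ... | no other = ⊥-elim (<-irrefl refl (<-≤-trans v-light (double-cancel-≤ (begin
        δ + δ
          ≤⟨ +-mono-≤ (Heavy⇒δ≤ δ≥0 heavy _ (visits-nonZero g s i x₀))
                      (Heavy⇒δ≤ δ≥0 heavy _ (visits-nonZero g s i x)) ⟩
        frac n (visits n g s i (run g s i x₀)) + frac n (visits n g s i (run g s i x))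
          ≡⟨ sym (frac-+ n _ _) ⟩
        frac n (visits n g s i (run g s i x₀) ℕ.+ visits n g s i (run g s i x))
          ≤⟨ frac-mono-≤ n (visits+visits≤2·inflow i<n L x₀-enters (==⇒≡ x-enters) (λ same _ → other (sym same))) ⟩
        frac n (c ℕ.+ c)
          ≡⟨ frac-+ n c c ⟩
        frac n c + frac n c ∎))))
        where open ≤-Reasoning

  -- Pruning, probes and the hybrid argument

  _[_≔_] : ∀ {w} → Layers w → ℕ → Layer w → Layers w
  (g [ k ≔ L ]) j = if does (j ℕ.≟ k) then L else g j

  [≔]-same : ∀ {w} (g : Layers w) k L → (g [ k ≔ L ]) k ≡ L
  [≔]-same g k L rewrite dec-true (k ℕ.≟ k) refl = refl

  [≔]-other : ∀ {w} (g : Layers w) {k j} L → j ≢ k → (g [ k ≔ L ]) j ≡ g j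
  [≔]-other g {k} {j} L j≢k rewrite dec-false (j ℕ.≟ k) j≢k = refl

  module Pruning (n : ℕ) {w : ℕ} (δ : ℚ) (δ≥0 : 0ℚ ≤ δ) (s : Fin w) where

    θ : ℚ
    θ = thr δ (w ∸ 1)

    Small : ℕ → Set
    Small c = c ≢ 0 × frac n c < θ

    small? : ∀ c → Dec (Small c)
    small? c = ¬? (c ℕ.≟ 0) ×-dec (frac n c <? θ)

    Big : ℕ → Set
    Big c = c ≢ 0 × θ ≤ frac n c

    opaque
      redirectTarget : Layers w → ℕ → Fin w
      redirectTarget g k = pick (Fin.any? (λ v → ¬? (c v ℕ.≟ 0) ×-dec (θ ≤? frac n (c v))))
        where
        c : Fin w → ℕ
        c = inflow n g s k (g k)
        pick : Dec (∃ λ v → Big (c v)) → Fin w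
        pick (yes (v , _)) = v
        pick (no _)        = s

      redirectTarget-spec : ∀ g k → Big (inflow n g s k (g k) (redirectTarget g k)) ⊎
                                    ((∀ v → ¬ Big (inflow n g s k (g k) v)) × redirectTarget g k ≡ s)
      redirectTarget-spec g k
        with Fin.any? (λ v → ¬? (inflow n g s k (g k) v ℕ.≟ 0) ×-dec (θ ≤? frac n (inflow n g s k (g k) v)))
      ... | yes (v , big) = inj₁ big
      ... | no no-big     = inj₂ ((λ v big → no-big (v , big)) , refl)

      -- When no vertex is heavy, every edge is redirected and the start vertex gets probability 1.
      prune : Layers w → ℕ → Layer w
      prune g k u b = if does (small? (inflow n g s k (g k) (g k u b))) then redirectTarget g k else g k u b

      prune-kept : ∀ g k u b → ¬ Small (inflow n g s k (g k) (g k u b)) → prune g k u b ≡ g k u b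
      prune-kept g k u b not-small rewrite dec-false (small? (inflow n g s k (g k) (g k u b))) not-small = refl

      prune-redirected : ∀ g k u b → Small (inflow n g s k (g k) (g k u b)) → prune g k u b ≡ redirectTarget g k
      prune-redirected g k u b small rewrite dec-true (small? (inflow n g s k (g k) (g k u b))) small = refl

    module _ (g : Layers w) (k : ℕ) where

      private
        c c′ : Fin w → ℕ
        c  = inflow n g s k (g k)
        c′ = inflow n g s k (prune g k)

      θ≤kept : ∀ v → Big (c v) → θ ≤ frac n (c′ v)
      θ≤kept v (_ , θ≤cv) = ≤-trans θ≤cv (frac-mono-≤ n (count-mono {n} still-enters))
        where
        still-enters : ∀ x → g k (run g s k x) (bitAt x k) == v ≡ true → prune g k (run g s k x) (bitAt x k) == v ≡ true
        still-enters x enters =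
          subst (λ z → z == v ≡ true) (sym (trans (prune-kept g k _ _ not-small) (==⇒≡ enters))) (==-refl v)
          where
          not-small : ¬ Small (c (g k (run g s k x) (bitAt x k)))
          not-small (_ , ct<θ) = <-irrefl refl (<-≤-trans (subst (λ z → frac n (c z) < θ) (==⇒≡ enters) ct<θ) θ≤cv)

      target-visited : ∀ (x : Input n) → c (g k (run g s k x) (bitAt x k)) ≢ 0
      target-visited x = count-nonZero _ x (==-refl (g k (run g s k x) (bitAt x k)))

      θ≤pruned : θ ≤ 1ℚ → ∀ v → c′ v ≢ 0 → θ ≤ frac n (c′ v)
      θ≤pruned θ≤1 v v-visited with inflow-witness g s k (prune g k) v v-visited
      ... | x , x-enters-v with small? (c t)
        where
        t : Fin w
        t = g k (run g s k x) (bitAt x k)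
      ... | no not-small = subst (λ z → θ ≤ frac n (c′ z)) (trans (sym (prune-kept g k _ _ not-small)) x-enters-v)
                             (θ≤kept _ (target-visited x , ≮⇒≥ (not-small ∘ (target-visited x ,_))))
      ... | yes small with redirectTarget-spec g k
      ...   | inj₁ big = subst (λ z → θ ≤ frac n (c′ z)) (trans (sym (prune-redirected g k _ _ small)) x-enters-v)
                           (θ≤kept (redirectTarget g k) big)
      ...   | inj₂ (no-big , target≡s) =
        subst (λ z → θ ≤ frac n (c′ z)) s≡v (≤-trans θ≤1 (≤-reflexive (sym everyone-at-s)))
        where
        s≡v : s ≡ v
        s≡v = trans (sym target≡s) (trans (sym (prune-redirected g k _ _ small)) x-enters-v)
        redirected : ∀ y → prune g k (run g s k y) (bitAt y k) == s ≡ true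
        redirected y = subst (λ z → z == s ≡ true)
          (sym (trans (prune-redirected g k _ _ (target-visited y , ≰⇒> (no-big _ ∘ (target-visited y ,_)))) target≡s))
          (==-refl s)
        everyone-at-s : frac n (c′ s) ≡ 1ℚ
        everyone-at-s = trans (cong (frac n) (trans (count-cong {n} redirected) (count-all n))) (frac-all n)

      Heavy-prune : θ ≤ 1ℚ → Heavy n δ c′
      Heavy-prune θ≤1 v v-visited = ≤-trans
        (thr-mono-≤ δ≥0 (ℕ.∸-monoʳ-≤ w (countᶠ-nonZero (isNonZero ∘ c′) v (≢0⇒isNonZero v-visited))))
        (θ≤pruned θ≤1 v v-visited)

    HeavyUpTo : ℕ → Layers w → Set
    HeavyUpTo k g = ∀ i → i ℕ.≤ k → Heavy n δ (visits n g s i)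

    Heavy-start : θ ≤ 1ℚ → ∀ g → Heavy n δ (visits n g s 0)
    Heavy-start θ≤1 g v v-visited = begin
      thr δ (w ∸ support (visits n g s 0)) ≤⟨ thr-mono-≤ δ≥0 (ℕ.∸-monoʳ-≤ w
                                               (countᶠ-nonZero (isNonZero ∘ visits n g s 0) v (≢0⇒isNonZero v-visited))) ⟩
      θ                                    ≤⟨ θ≤1 ⟩
      1ℚ                                   ≡⟨ sym (frac-all n) ⟩
      frac n (2 ℕ.^ n)                     ≡⟨ cong (frac n) (trans (sym (count-all n)) (count-cong {n} (λ _ → sym s==v))) ⟩
      frac n (visits n g s 0 v)            ∎
      where
      open ≤-Reasoning
      s==v : s == v ≡ true
      s==v = proj₂ (count-witness {n} _ v-visited)

    opaque
      pruneLayers : (ℕ → Bool) → Layers w → ℕ → Layers w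
      pruneLayers S g zero    = g
      pruneLayers S g (suc k) =
        if S k then pruneLayers S g k [ k ≔ prune (pruneLayers S g k) k ] else pruneLayers S g k

      pruneLayers-zero : ∀ S g → pruneLayers S g 0 ≡ g
      pruneLayers-zero S g = refl

      pruneLayers-other : ∀ S g k {j} → j ≢ k → ∀ u b → pruneLayers S g (suc k) j u b ≡ pruneLayers S g k j u b
      pruneLayers-other S g k {j} j≢k u b with S k
      ... | true  = cong (λ L → L u b) ([≔]-other (pruneLayers S g k) _ j≢k)
      ... | false = refl

      pruneLayers-late : ∀ S g k j → k ℕ.≤ j → ∀ u b → pruneLayers S g k j u b ≡ g j u b
      pruneLayers-late S g zero    j _   u b = refl
      pruneLayers-late S g (suc k) j k<j u b =
        trans (pruneLayers-other S g k (ℕ.>⇒≢ k<j) u b) (pruneLayers-late S g k j (ℕ.<⇒≤ k<j) u b)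

      pruneLayers-pruned : ∀ S g k → S k ≡ true → ∀ u b → pruneLayers S g (suc k) k u b ≡ prune (pruneLayers S g k) k u b
      pruneLayers-pruned S g k Sk rewrite Sk = λ u b → cong (λ L → L u b) ([≔]-same (pruneLayers S g k) k _)

      pruneLayers-unpruned : ∀ S g k → S k ≡ false → pruneLayers S g (suc k) ≡ pruneLayers S g k
      pruneLayers-unpruned S g k Sk rewrite Sk = refl

    module _ (S : ℕ → Bool) (g : Layers w) where

      run-pruneLayers : ∀ k i (x : Input n) → i ℕ.≤ k → run (pruneLayers S g (suc k)) s i x ≡ run (pruneLayers S g k) s i x
      run-pruneLayers k i x i≤k = run-cong s i x (λ j j<i → pruneLayers-other S g k (ℕ.<⇒≢ (ℕ.<-≤-trans j<i i≤k)))

      HeavyUpTo-pruneLayers : θ ≤ 1ℚ → (∀ k → S k ≡ false → NonColliding (g k)) →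
                              ∀ k → k ℕ.≤ n → HeavyUpTo k (pruneLayers S g k)
      HeavyUpTo-pruneLayers θ≤1 unpruned-nonColliding zero    _   zero _ = Heavy-start θ≤1 (pruneLayers S g 0)
      HeavyUpTo-pruneLayers θ≤1 unpruned-nonColliding (suc k) k<n i i≤1+k with ℕ.m≤n⇒m<n∨m≡n i≤1+k
      ... | inj₁ (s≤s i≤k) = Heavy-cong (λ v → count-cong {n} (λ x → cong (_== v) (sym (run-pruneLayers k i x i≤k))))
                               (HeavyUpTo-pruneLayers θ≤1 unpruned-nonColliding k (ℕ.<⇒≤ k<n) i i≤k)
      ... | inj₂ refl = next-layer (S k) refl
        where
        IH : HeavyUpTo k (pruneLayers S g k)
        IH = HeavyUpTo-pruneLayers θ≤1 unpruned-nonColliding k (ℕ.<⇒≤ k<n)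
        next-layer : ∀ b → S k ≡ b → Heavy n δ (visits n (pruneLayers S g (suc k)) s (suc k))
        next-layer true Sk = Heavy-cong (λ v → count-cong {n} (λ x → cong (_== v) (sym (next x))))
                               (Heavy-prune (pruneLayers S g k) k θ≤1)
          where
          next : ∀ x → run (pruneLayers S g (suc k)) s (suc k) x ≡
                       prune (pruneLayers S g k) k (run (pruneLayers S g k) s k x) (bitAt x k)
          next x = trans (cong (λ u → pruneLayers S g (suc k) k u (bitAt x k)) (run-pruneLayers k k x ℕ.≤-refl))
                         (pruneLayers-pruned S g k Sk _ _)
        next-layer false Sk = subst (λ h → Heavy n δ (visits n h s (suc k))) (sym (pruneLayers-unpruned S g k Sk))
            (Heavy-permutation (pruneLayers S g k) s k δ≥0 k<n (pruneLayers S g k k) nonColliding (IH k ℕ.≤-refl))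
          where
          nonColliding : NonColliding (pruneLayers S g k k)
          nonColliding b {u} {u′} e = unpruned-nonColliding k Sk b
            (trans (sym (pruneLayers-late S g k k ℕ.≤-refl u b)) (trans e (pruneLayers-late S g k k ℕ.≤-refl u′ b)))

    embed : Layer w → Layer (suc w)
    embed L Fin.zero    b = Fin.zero
    embed L (Fin.suc u) b = Fin.suc (L u b)

    collapse : (Fin w → Bool → Bool) → Layer (suc w)
    collapse test Fin.zero    b = Fin.zero
    collapse test (Fin.suc u) b = if test u b then Fin.suc s else Fin.zero

    -- A probe has one extra, absorbing vertex zero. It simulates g up to layer k, where it moves
    -- to the start vertex if the test passes and to zero otherwise, and then stands still; so it
    -- computes the test and is δ-reachable when both outcomes have probability at least δ.
    probeLayers : Layers w → ℕ → (Fin w → Bool → Bool) → Layers (suc w)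
    probeLayers g k test j with ℕ.<-cmp j k
    ... | tri< _ _ _ = embed (g j)
    ... | tri≈ _ _ _ = collapse test
    ... | tri> _ _ _ = λ u b → u

    liftAccept : (Fin w → Bool) → Fin (suc w) → Bool
    liftAccept acc Fin.zero    = false
    liftAccept acc (Fin.suc u) = acc u

    probe : Layers w → ℕ → (Fin w → Bool → Bool) → (Fin w → Bool) → ROBP n (suc w)
    probe g k test acc = mkROBP (probeLayers g k test) (Fin.suc s) (liftAccept acc)

    module _ (g : Layers w) (k : ℕ) (test : Fin w → Bool → Bool) where

      verdict : Input n → Fin (suc w)
      verdict x = if test (run g s k x) (bitAt x k) then Fin.suc s else Fin.zero

      run-probe-≤ : ∀ i (x : Input n) → i ℕ.≤ k → run (probeLayers g k test) (Fin.suc s) i x ≡ Fin.suc (run g s i x)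
      run-probe-≤ zero    x _   = refl
      run-probe-≤ (suc i) x i<k with ℕ.<-cmp i k
      ... | tri< _ _ _ = cong (λ u → embed (g i) u (bitAt x i)) (run-probe-≤ i x (ℕ.<⇒≤ i<k))
      ... | tri≈ _ i≡k _ = ⊥-elim (ℕ.<⇒≢ i<k i≡k)
      ... | tri> _ _ k<i = ⊥-elim (ℕ.<-asym i<k k<i)

      run-probe-> : ∀ i (x : Input n) → k ℕ.< i → run (probeLayers g k test) (Fin.suc s) i x ≡ verdict x
      run-probe-> (suc i) x (s≤s k≤i) with ℕ.<-cmp i k
      ... | tri< i<k _ _ = ⊥-elim (ℕ.≤⇒≯ k≤i i<k)
      ... | tri≈ _ refl _ = cong (λ u → collapse test u (bitAt x i)) (run-probe-≤ i x ℕ.≤-refl)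
      ... | tri> _ _ k<i = run-probe-> i x k<i

      passes : Input n → Bool
      passes x = test (run g s k x) (bitAt x k)

      visits-probe-below : ∀ i → i ℕ.≤ k → ∀ v →
                           visits n (probeLayers g k test) (Fin.suc s) i (Fin.suc v) ≡ visits n g s i v
      visits-probe-below i i≤k v = count-cong {n} (λ x → cong (_== Fin.suc v) (run-probe-≤ i x i≤k))

      visits-probe-below-dead : ∀ i → i ℕ.≤ k → visits n (probeLayers g k test) (Fin.suc s) i Fin.zero ≡ 0
      visits-probe-below-dead i i≤k = count-none {n} (λ x → cong (_== Fin.zero) (run-probe-≤ i x i≤k))

      visits-probe-above-dead : ∀ i → k ℕ.< i →
                                visits n (probeLayers g k test) (Fin.suc s) i Fin.zero ≡ count (not ∘ passes)
      visits-probe-above-dead i k<i = count-cong {n} (λ x → trans (cong (_== Fin.zero) (run-probe-> i x k<i)) (verdict-dead x))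
        where
        verdict-dead : ∀ x → verdict x == Fin.zero ≡ not (passes x)
        verdict-dead x with passes x
        ... | true  = refl
        ... | false = refl

      visits-probe-above : ∀ i → k ℕ.< i → ∀ v → visits n (probeLayers g k test) (Fin.suc s) i (Fin.suc v) ≡
                                                   count (λ x → passes x ∧ (s == v))
      visits-probe-above i k<i v = count-cong {n} (λ x → trans (cong (_== Fin.suc v) (run-probe-> i x k<i)) (verdict-alive x))
        where
        verdict-alive : ∀ x → verdict x == Fin.suc v ≡ passes x ∧ (s == v)
        verdict-alive x with passes x
        ... | true  = refl
        ... | false = refl

      probe-reachable : ∀ acc → HeavyUpTo k g →
                        (k ℕ.< n → δ ≤ frac n (count passes)) → (k ℕ.< n → frac n (count passes) + δ ≤ 1ℚ) →
                        Reachable δ (probe g k test acc)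
      probe-reachable acc heavy δ≤passing passing+δ≤1 =
        reachable-mkROBP δ (probeLayers g k test) (Fin.suc s) (liftAccept acc) bound
        where
        bound : ∀ i → i ℕ.≤ n → ∀ v → visits n (probeLayers g k test) (Fin.suc s) i v ≢ 0 →
                δ ≤ frac n (visits n (probeLayers g k test) (Fin.suc s) i v)
        bound i i≤n v v-visited with i ℕ.≤? k
        bound i i≤n Fin.zero    visited | yes i≤k = ⊥-elim (visited (visits-probe-below-dead i i≤k))
        bound i i≤n (Fin.suc v) visited | yes i≤k rewrite visits-probe-below i i≤k v =
          Heavy⇒δ≤ δ≥0 (heavy i i≤k) v visited
        bound i i≤n Fin.zero    visited | no i≰k rewrite visits-probe-above-dead i (ℕ.≰⇒> i≰k) =
          +-cancelˡ-≤ (frac n (count passes)) (≤-trans (passing+δ≤1 k<n) (≤-reflexive (sym passing+failing≡1)))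
          where
          k<n : k ℕ.< n
          k<n = ℕ.<-≤-trans (ℕ.≰⇒> i≰k) i≤n
          passing+failing≡1 : frac n (count passes) + frac n (count (not ∘ passes)) ≡ 1ℚ
          passing+failing≡1 = trans (sym (frac-+ n _ _)) (trans (cong (frac n) (count+count-not passes)) (frac-all n))
        bound i i≤n (Fin.suc v) visited | no i≰k rewrite visits-probe-above i (ℕ.≰⇒> i≰k) v with s == v
        ... | true  = subst (λ c → δ ≤ frac n c) (count-cong {n} (λ x → sym (Bool.∧-identityʳ (passes x))))
                        (δ≤passing (ℕ.<-≤-trans (ℕ.≰⇒> i≰k) i≤n))
        ... | false = ⊥-elim (visited (count-none {n} (λ x → Bool.∧-zeroʳ (passes x))))

      eval-probe-test : k ℕ.< n → ∀ x → eval (probe g k test (λ _ → true)) x ≡ passes x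
      eval-probe-test k<n x = trans (eval-mkROBP (probeLayers g k test) (Fin.suc s) (liftAccept (λ _ → true)) x)
        (trans (cong (liftAccept (λ _ → true)) (run-probe-> n x k<n)) verdict-accepted)
        where
        verdict-accepted : liftAccept (λ _ → true) (verdict x) ≡ passes x
        verdict-accepted with passes x
        ... | true  = refl
        ... | false = refl

    eval-probe-complete : ∀ g test acc (x : Input n) → eval (probe g n test acc) x ≡ acc (run g s n x)
    eval-probe-complete g test acc x = trans (eval-mkROBP (probeLayers g n test) (Fin.suc s) (liftAccept acc) x)
      (cong (liftAccept acc) (run-probe-≤ g n test n x ℕ.≤-refl))

    module Hybrid (gP : Layers w) (S : ℕ → Bool) (unpruned-nonColliding : ∀ k → S k ≡ false → NonColliding (gP k))
                  (θ≤1 : θ ≤ 1ℚ) (acc : Fin w → Bool) (D : Distribution n) (ε : ℚ)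
                  (fools : ∀ (P : ROBP n (suc w)) → Reachable δ P → Fools D ε (eval P)) where

      hybrid : ℕ → Layers w
      hybrid = pruneLayers S gP

      computes : ℕ → Input n → Bool
      computes k x = acc (run (hybrid k) s n x)

      err : ℕ → ℚ
      err k = bias D (computes k)

      heavy : ∀ k → k ℕ.≤ n → HeavyUpTo k (hybrid k)
      heavy = HeavyUpTo-pruneLayers S gP θ≤1 unpruned-nonColliding

      err-last : err n ≤ ε
      err-last = subst (_≤ ε) (bias-cong D (eval-probe-complete (hybrid n) (λ _ _ → true) acc))
        (fools (probe (hybrid n) n (λ _ _ → true) acc)
          (probe-reachable (hybrid n) n (λ _ _ → true) acc (heavy n ℕ.≤-refl) n≮n n≮n))
        where
        n≮n : ∀ {A : Set} → n ℕ.< n → A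
        n≮n n<n = ⊥-elim (ℕ.<-irrefl refl n<n)

      ε-nonNeg : 0ℚ ≤ ε
      ε-nonNeg = ≤-trans (bias-nonNeg D (computes n)) err-last

      test-bound : ∀ k → k ℕ.< n → ∀ test → let M = count (passes (hybrid k) k test) in
                   δ ≤ frac n M → frac n M + δ ≤ 1ℚ → PrD D (passes (hybrid k) k test) ≤ frac n M + ε
      test-bound k k<n test δ≤M M+δ≤1 = subst (λ p → PrD D (passes (hybrid k) k test) ≤ p + ε)
        (PrU≡frac-count (passes (hybrid k) k test))
        (bias≤⇒PrD≤ D (subst (_≤ ε) (bias-cong D (eval-probe-test (hybrid k) k test k<n))
          (fools (probe (hybrid k) k test (λ _ → true))
            (probe-reachable (hybrid k) k test (λ _ → true) (heavy k (ℕ.<⇒≤ k<n)) (λ _ → δ≤M) (λ _ → M+δ≤1)))))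

      err-unpruned : ∀ k → S k ≡ false → err k ≡ err (suc k)
      err-unpruned k Sk = cong (λ h → bias D (λ x → acc (run h s n x))) (sym (pruneLayers-unpruned S gP k Sk))

      module PrunedStep (k : ℕ) (k<n : k ℕ.< n) (Sk : S k ≡ true) (thr-w≤1 : thr δ w ≤ 1ℚ) where

        private
          g : Layers w
          g = hybrid k
          c : Fin w → ℕ
          c = inflow n g s k (g k)

        enters : Fin w → Input n → Bool
        enters v x = g k (run g s k x) (bitAt x k) == v

        Hit : Input n → Bool
        Hit x = does (small? (c (g k (run g s k x) (bitAt x k))))

        HitAt : Fin w → Input n → Bool
        HitAt v x = does (small? (c v)) ∧ enters v x

        computes-agree : ∀ x → Hit x ≡ false → computes (suc k) x ≡ computes k x
        computes-agree x no-hit = cong acc (subst (λ m → run (hybrid (suc k)) s m x ≡ run g s m x) (ℕ.m∸n+n≡m k<n)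
          (run-cong-from s (suc k) x next-agrees (λ j k<j → pruneLayers-other S gP k (ℕ.>⇒≢ k<j)) (n ∸ suc k)))
          where
          next-agrees : run (hybrid (suc k)) s (suc k) x ≡ run g s (suc k) x
          next-agrees = trans (cong (λ u → hybrid (suc k) k u (bitAt x k)) (run-pruneLayers S gP k k x ℕ.≤-refl))
            (trans (pruneLayers-pruned S gP k Sk _ _) (prune-kept g k _ _ (does-false⇒¬ (small? _) no-hit)))

        Hit⊆⋃HitAt : ∀ x → Hit x ≡ true → ∃ λ v → HitAt v x ≡ true
        Hit⊆⋃HitAt x hit = g k (run g s k x) (bitAt x k) , cong₂ _∧_ hit (==-refl (g k (run g s k x) (bitAt x k)))

        enters-bound : ∀ v test → (∀ x → enters v x ≡ true → passes g k test x ≡ true) →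
                       let M = count (passes g k test) in
                       δ ≤ frac n M → frac n M + δ ≤ 1ℚ → frac n M + frac n (c v) ≤ thr δ w →
                       PrD D (enters v) + PrU (enters v) ≤ ε + thr δ w
        enters-bound v test enters⊆passes δ≤M M+δ≤1 M+m≤thr = begin
          PrD D (enters v) + PrU (enters v)
            ≤⟨ +-mono-≤ (≤-trans (wsum-mono (mass-nonneg D) (allInputs n) enters⊆passes) (test-bound k k<n test δ≤M M+δ≤1))
                        (≤-reflexive (PrU≡frac-count (enters v))) ⟩
          frac n M + ε + frac n (c v)
            ≡⟨ rearrange (frac n M) ε (frac n (c v)) ⟩
          ε + (frac n M + frac n (c v))
            ≤⟨ +-monoʳ-≤ ε M+m≤thr ⟩
          ε + thr δ w ∎
          where
          open ≤-Reasoning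
          M : ℕ
          M = count (passes g k test)
          rearrange : ∀ a e b → a + e + b ≡ e + (a + b)
          rearrange = solve-∀ ringℚ

        -- A light vertex of probability below δ has a unique predecessor (two would give it δ),
        -- of probability below 2δ; the probe then tests that predecessor instead.
        enters-small-bound : ∀ v → Small (c v) → PrD D (enters v) + PrU (enters v) ≤ ε + thr δ w
        enters-small-bound v (v-visited , m<θ) with δ ≤? frac n (c v)
        ... | yes δ≤m = enters-bound v (λ u b → g k u b == v) (λ _ e → e) δ≤m
                (≤-trans (+-mono-≤ (<⇒≤ m<θ) (δ≤thr δ≥0 (w ∸ 1))) (≤-trans (≤-reflexive (thr-pred δ s)) thr-w≤1))
                (≤-trans (+-mono-≤ (<⇒≤ m<θ) (<⇒≤ m<θ)) (≤-reflexive (thr-pred δ s)))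
        ... | no δ≰m with unique-predecessor g s k δ≥0 k<n (heavy k (ℕ.<⇒≤ k<n) k ℕ.≤-refl) (g k) v v-visited m<δ
          where
          m<δ : frac n (c v) < δ
          m<δ = ≰⇒> δ≰m
        ...   | u₀ , only-u₀ , u₀-visited , u₀≤2c = enters-bound v (λ u b → u == u₀)
                  (λ x e → subst (λ u → u == u₀ ≡ true) (sym (only-u₀ x e)) (==-refl u₀))
                  (Heavy⇒δ≤ δ≥0 (heavy k (ℕ.<⇒≤ k<n) k ℕ.≤-refl) u₀ u₀-visited)
                  (≤-trans (+-monoˡ-≤ δ M≤2δ) (≤-trans (3δ≤thr δ≥0 2≤w) thr-w≤1))
                  (≤-trans (+-mono-≤ M≤2δ (<⇒≤ m<δ)) (3δ≤thr δ≥0 2≤w))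
          where
          m<δ : frac n (c v) < δ
          m<δ = ≰⇒> δ≰m
          M≤2δ : frac n (visits n g s k u₀) ≤ δ + δ
          M≤2δ = ≤-trans (frac-mono-≤ n u₀≤2c)
                         (≤-trans (≤-reflexive (frac-+ n (c v) (c v))) (+-mono-≤ (<⇒≤ m<δ) (<⇒≤ m<δ)))
          2≤w : 2 ℕ.≤ w
          2≤w with 2 ℕ.≤? w
          ... | yes 2≤w = 2≤w
          ... | no 2≰w =
            ⊥-elim (<-irrefl refl (<-≤-trans m<δ (≤-trans (δ≤thr δ≥0 (w ∸ 1)) (≤-trans θ≤1 (≤-reflexive (sym m≡1))))))
            where
            m≡1 : frac n (c v) ≡ 1ℚ
            m≡1 = trans (cong (frac n) (trans (count-cong {n} (λ x → dec-true (g k (run g s k x) (bitAt x k) Fin.≟ v)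
                                                                               (Fin≤1-irrelevant (ℕ.s≤s⁻¹ (ℕ.≰⇒> 2≰w)) _ v)))
                                              (count-all n)))
                        (frac-all n)

        HitAt-bound : ∀ v → PrD D (HitAt v) + PrU (HitAt v) ≤ ε + thr δ w
        HitAt-bound v with small? (c v)
        ... | no not-small = ≤-trans (≤-reflexive (cong₂ _+_ (wsum-none (mass D) (allInputs n) none)
                                                             (wsum-none (λ _ → half^ n) (allInputs n) none)))
                               (+-mono-≤ ε-nonNeg (thr-nonNeg δ≥0 w))
          where
          none : ∀ x → HitAt v x ≡ false
          none x = cong (_∧ enters v x) (dec-false (small? (c v)) not-small)
        ... | yes small = ≤-trans (≤-reflexive (cong₂ _+_ (wsum-cong (mass D) (allInputs n) same)
                                                          (wsum-cong (λ _ → half^ n) (allInputs n) same)))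
                            (enters-small-bound v small)
          where
          same : ∀ x → HitAt v x ≡ enters v x
          same x = cong (_∧ enters v x) (dec-true (small? (c v)) small)

        err-pruned : err k ≤ err (suc k) + ℕtoℚ w * (ε + thr δ w)
        err-pruned = begin
          err k
            ≤⟨ bias-agree D {h = Hit} (λ x no-hit → sym (computes-agree x no-hit)) ⟩
          err (suc k) + (PrD D Hit + PrU Hit)
            ≤⟨ +-monoʳ-≤ (err (suc k)) (+-mono-≤ (wsum-⋃ (mass-nonneg D) (allInputs n) HitAt Hit⊆⋃HitAt)
                                                  (wsum-⋃ (λ _ → half^-nonNeg n) (allInputs n) HitAt Hit⊆⋃HitAt)) ⟩
          err (suc k) + (sum (λ v → PrD D (HitAt v)) + sum (λ v → PrU (HitAt v)))
            ≡⟨ cong (err (suc k) +_) (sym (∑-distrib-+ (λ v → PrD D (HitAt v)) (λ v → PrU (HitAt v)))) ⟩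
          err (suc k) + sum (λ v → PrD D (HitAt v) + PrU (HitAt v))
            ≤⟨ +-monoʳ-≤ (err (suc k)) (sum≤ _ (ε + thr δ w) HitAt-bound) ⟩
          err (suc k) + ℕtoℚ w * (ε + thr δ w) ∎
          where open ≤-Reasoning

      K : ℚ
      K = ℕtoℚ w * (ε + thr δ w)

      K-nonNeg : 0ℚ ≤ K
      K-nonNeg = nonNegative⁻¹ K {{nonNeg*nonNeg⇒nonNeg (ℕtoℚ w) {{nonNegative (ℕtoℚ-nonNeg w)}} (ε + thr δ w)
        {{nonNegative (+-mono-≤ ε-nonNeg (thr-nonNeg δ≥0 w))}}}}

      module _ (pruned⇒thr-w≤1 : ∀ k → S k ≡ true → thr δ w ≤ 1ℚ) where

        err-step-pruned : ∀ k → k ℕ.< n → S k ≡ true → err k ≤ err (suc k) + K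
        err-step-pruned k k<n Sk = PrunedStep.err-pruned k k<n Sk (pruned⇒thr-w≤1 k Sk)

        err-step : ∀ k → k ℕ.< n → err k ≤ err (suc k) + ℕtoℚ (indicatorℕ (S k)) * K
        err-step k k<n = by-case (S k) refl
          where
          by-case : ∀ b → S k ≡ b → err k ≤ err (suc k) + ℕtoℚ (indicatorℕ (S k)) * K
          by-case true  Sk = subst (λ b → err k ≤ err (suc k) + ℕtoℚ (indicatorℕ b) * K) (sym Sk)
            (subst (λ z → err k ≤ err (suc k) + z) (sym (*-identityˡ K)) (err-step-pruned k k<n Sk))
          by-case false Sk = subst (λ b → err k ≤ err (suc k) + ℕtoℚ (indicatorℕ b) * K) (sym Sk)
            (≤-reflexive (trans (err-unpruned k Sk) (sym (trans (cong (err (suc k) +_) (*-zeroˡ K)) (+-identityʳ _)))))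

        err-telescope : ∀ m → m ℕ.≤ n → err 0 ≤ err m + ℕtoℚ (countBelow m S) * K
        err-telescope zero    _   = ≤-reflexive (sym (trans (cong (err 0 +_) (*-zeroˡ K)) (+-identityʳ _)))
        err-telescope (suc m) m<n = begin
          err 0                       ≤⟨ err-telescope m (ℕ.<⇒≤ m<n) ⟩
          err m + c * K               ≤⟨ +-monoˡ-≤ (c * K) (err-step m m<n) ⟩
          err (suc m) + i * K + c * K ≡⟨ collect (err (suc m)) i c K ⟩
          err (suc m) + (c + i) * K   ≡⟨ cong (λ z → err (suc m) + z * K) (sym (ℕtoℚ-+ (countBelow m S) (indicatorℕ (S m)))) ⟩
          err (suc m) + ℕtoℚ (countBelow m S ℕ.+ indicatorℕ (S m)) * K ∎
          where
          open ≤-Reasoning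
          c i : ℚ
          c = ℕtoℚ (countBelow m S)
          i = ℕtoℚ (indicatorℕ (S m))
          collect : ∀ e i c k → e + i * k + c * k ≡ e + (c + i) * k
          collect = solve-∀ ringℚ

        err-first : ∀ ℓ → countBelow n S ℕ.≤ ℓ → err 0 ≤ ε + ℕtoℚ ℓ * K
        err-first ℓ pruned≤ℓ = ≤-trans (err-telescope n ℕ.≤-refl)
          (+-mono-≤ err-last (*-monoʳ-≤-nonNeg K {{nonNegative K-nonNeg}} (ℕtoℚ-mono-≤ pruned≤ℓ)))

  lookupLayer-toℕ : ∀ {w m} (v : Vec (Layer w) m) (j : Fin m) → lookupLayer v (toℕ j) ≡ Vec.lookup v j
  lookupLayer-toℕ (f ∷ v) Fin.zero    = refl
  lookupLayer-toℕ (f ∷ v) (Fin.suc j) = lookupLayer-toℕ v j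

  nonColliding-unlisted : ∀ {n w} (P : ROBP n w) (S : List (Fin n)) → (∀ j → Colliding P j → j ∈ S) →
                          ∀ k → listed S k ≡ false → NonColliding (lookupLayer (layers P) k)
  nonColliding-unlisted {n} P S colliding⊆S k unlisted b {u} {u′} same-target with k ℕ.<? n
  ... | no k≮n =
    trans (sym (beyond (layers P) k (ℕ.≮⇒≥ k≮n) u b)) (trans same-target (beyond (layers P) k (ℕ.≮⇒≥ k≮n) u′ b))
    where
    beyond : ∀ {m} (v : Vec (Layer _) m) k → m ℕ.≤ k → ∀ u b → lookupLayer v k u b ≡ u
    beyond []      k       _         u b = refl
    beyond (f ∷ v) (suc k) (s≤s m≤k) u b = beyond v k m≤k u b
  ... | yes k<n with u Fin.≟ u′
  ...   | yes u≡u′ = u≡u′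
  ...   | no u≢u′ = ⊥-elim (false≢true (trans (sym unlisted)
                      (subst (λ i → listed S i ≡ true) (Fin.toℕ-fromℕ< k<n) (∈⇒listed (colliding⊆S j collision)))))
    where
    j : Fin n
    j = Fin.fromℕ< k<n
    layer-j : lookupLayer (layers P) k ≡ Vec.lookup (layers P) j
    layer-j = trans (cong (lookupLayer (layers P)) (sym (Fin.toℕ-fromℕ< k<n))) (lookupLayer-toℕ (layers P) j)
    collision : Colliding P j
    collision = u , u′ , b , u≢u′ ,
                trans (cong (λ L → L u b) (sym layer-j)) (trans same-target (cong (λ L → L u′ b) layer-j))

  listed-short : ∀ {n} (S : List (Fin n)) → length S ℕ.≤ 0 → ∀ k → listed S k ≡ false
  listed-short [] _ k = refl

  bound-shape : ∀ ℓ w ε δ → ε + ℕtoℚ ℓ * (ℕtoℚ w * (ε + thr δ w)) ≡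
                            ℕtoℚ (ℓ ℕ.* w ℕ.+ 1) * ε + ℕtoℚ (2 ℕ.^ w ℕ.* w ℕ.* ℓ) * δ
  bound-shape ℓ w ε δ = begin
    ε + ℕtoℚ ℓ * (ℕtoℚ w * (ε + thr δ w))
      ≡⟨ cong (λ t → ε + ℕtoℚ ℓ * (ℕtoℚ w * (ε + t))) (thr-def δ w) ⟩
    ε + ℕtoℚ ℓ * (ℕtoℚ w * (ε + ℕtoℚ (2 ℕ.^ w) * δ))
      ≡⟨ expand ε (ℕtoℚ ℓ) (ℕtoℚ w) (ℕtoℚ (2 ℕ.^ w)) δ ⟩
    (ℕtoℚ ℓ * ℕtoℚ w + 1ℚ) * ε + ℕtoℚ (2 ℕ.^ w) * ℕtoℚ w * ℕtoℚ ℓ * δ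
      ≡⟨ sym (cong₂ (λ a b → a * ε + b * δ)
               (trans (ℕtoℚ-+ (ℓ ℕ.* w) 1) (cong (_+ 1ℚ) (ℕtoℚ-* ℓ w)))
               (trans (ℕtoℚ-* (2 ℕ.^ w ℕ.* w) ℓ) (cong (_* ℕtoℚ ℓ) (ℕtoℚ-* (2 ℕ.^ w) w)))) ⟩
    ℕtoℚ (ℓ ℕ.* w ℕ.+ 1) * ε + ℕtoℚ (2 ℕ.^ w ℕ.* w ℕ.* ℓ) * δ ∎
    where
    open ≡-Reasoning
    expand : ∀ e l w p d → e + l * (w * (e + p * d)) ≡ (l * w + 1ℚ) * e + p * w * l * d
    expand = solve-∀ ringℚ

  bias-bound : ∀ {n w} ℓ ε δ (D : Distribution n) → 0ℚ ≤ δ → δ ≤ half^ (w ∸ 1) →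
               (∀ (P : ROBP n (suc w)) → Reachable δ P → Fools D ε (eval P)) →
               ∀ (P : ROBP n w) → AtMostCollidingLayers ℓ P →
               bias D (eval P) ≤ ε + ℕtoℚ ℓ * (ℕtoℚ w * (ε + thr δ w))
  bias-bound {n} {w} ℓ ε δ D δ≥0 δ≤half fools P (S , |S|≤ℓ , colliding⊆S) =
    subst (_≤ ε + ℕtoℚ ℓ * K) (bias-cong D (λ x → sym (eval≡run x))) err₀≤
    where
    open Pruning n δ δ≥0 (start P)
    open Hybrid (lookupLayer (layers P)) (listed S) (nonColliding-unlisted P S colliding⊆S) (thr≤1 δ (w ∸ 1) δ≤half)
                (accept P) D ε fools
    eval≡run : ∀ x → eval P x ≡ computes 0 x
    eval≡run x = cong (accept P) (trans (runPrefix≡run (layers P) n x (start P) ℕ.≤-refl)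
                                        (cong (λ h → run h (start P) n x) (sym (pruneLayers-zero _ _))))
    pruned≤ℓ : countBelow n (listed S) ℕ.≤ ℓ
    pruned≤ℓ = ℕ.≤-trans (countBelow-listed n S) |S|≤ℓ
    -- If 2^w·δ > 1 the claimed bound exceeds 1 unless ℓ = 0, and then no layer is pruned.
    err₀≤ : err 0 ≤ ε + ℕtoℚ ℓ * K
    err₀≤ with thr δ w ≤? 1ℚ | ℓ ℕ.≟ 0
    ... | yes thr-w≤1 | _    = err-first (λ _ _ → thr-w≤1) ℓ pruned≤ℓ
    ... | no _        | yes ℓ≡0 = err-first nothing-pruned ℓ pruned≤ℓ
      where
      nothing-pruned : ∀ k → listed S k ≡ true → thr δ w ≤ 1ℚ
      nothing-pruned k listed = ⊥-elim (false≢true (trans (sym (listed-short S (subst (length S ℕ.≤_) ℓ≡0 |S|≤ℓ) k)) listed))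
    ... | no thr-w≰1  | no ℓ≢0  = begin
      err 0                                     ≤⟨ bias≤1 D (computes 0) ⟩
      1ℚ                                        ≤⟨ <⇒≤ (≰⇒> thr-w≰1) ⟩
      thr δ w                                   ≤⟨ ≤-trans (x≤y+x (thr δ w) ε-nonNeg) (x≤k*x w 1≤w ε+thr≥0) ⟩
      ℕtoℚ w * (ε + thr δ w)                    ≤⟨ x≤k*x ℓ (ℕ.n≢0⇒n>0 ℓ≢0) K-nonNeg ⟩
      ℕtoℚ ℓ * K                                ≤⟨ x≤y+x (ℕtoℚ ℓ * K) ε-nonNeg ⟩
      ε + ℕtoℚ ℓ * K                            ∎
      where
      open ≤-Reasoning
      1≤w : 1 ℕ.≤ w
      1≤w = ℕ.≤-trans (s≤s z≤n) (Fin.toℕ<n (ROBP.start P))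
      ε+thr≥0 : 0ℚ ≤ ε + thr δ w
      ε+thr≥0 = +-mono-≤ ε-nonNeg (thr-nonNeg δ≥0 w)

open Proof using (bias; bias-bound; bound-shape)
open import Data.Nat using (ℕ; suc; _*_; _+_; _^_; _∸_)
open import Data.Rational using (ℚ; 0ℚ; 1ℚ; _≤_) renaming (_*_ to _*ℚ_; _+_ to _+ℚ_)
open import Relation.Binary.PropositionalEquality using (subst)

lemma7p11 : (n w ℓ : ℕ) (ε δ : ℚ) (D : Distribution n) →
    0ℚ ≤ δ → δ ≤ half^ (w ∸ 1) →
    (∀ (P : ROBP n (suc w)) → Reachable δ P → Fools D ε (eval P)) →
    ∀ (P : ROBP n w) → AtMostCollidingLayers ℓ P →
      Fools D (ℕtoℚ (ℓ * w + 1) *ℚ ε +ℚ ℕtoℚ (2 ^ w * w * ℓ) *ℚ δ) (eval P)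
lemma7p11 n w ℓ ε δ D δ≥0 δ≤half fools P few-collisions =
  subst (bias D (eval P) ≤_) (bound-shape ℓ w ε δ) (bias-bound ℓ ε δ D δ≥0 δ≤half fools P few-collisions)
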